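{- Let $k$ be a positive integer that is not a perfect square, and $d$ a positive integer with $\dfrac{4d^2}{k-d^2}\in\mathbb{Z}$. Let $f(x)=\dfrac{dx+k}{x+d}$. Suppose $(k,d)$ is not of either of the following forms, for a positive integer $s$: (i) $k=5s^2$ and $d\in\{3s,5s\}$, where $2s$ divides some Fibonacci number $F_{2n+1}$ of odd index; (ii) $k=2s^2$ and $d=2s$, where $s$ divides some Pell number $G_{2n+1}$ of odd index. Then the orbit $\{f^n(\infty):n\ge1\}$ contains every Pellian convergent of $\sqrt{k}$, i.e. every $p/q$ with $p,q$ positive integers and $p^2-kq^2=\pm1$.
   Context: $F_0=0$, $F_1=1$, $F_{n+1}=F_n+F_{n-1}$; $G_0=0$, $G_1=1$, $G_{n+1}=2G_n+G_{n-1}$. $f$ acts on $\mathbb{R}\cup\{\infty\}$ with $f(\infty)=d$. -}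

module Defs where

open import Data.Nat using (ℕ; zero; suc; _+_; _*_)
open import Data.Product using (_×_; _,_; proj₁; proj₂)
open import Relation.Binary.PropositionalEquality using (_≡_)

F : ℕ → ℕ
F zero = 0
F (suc zero) = 1
F (suc (suc n)) = F (suc n) + F n

G : ℕ → ℕ
G zero = 0
G (suc zero) = 1
G (suc (suc n)) = 2 * G (suc n) + G n

-- Points of ℝ ∪ {∞} with nonnegative homogeneous coordinates (p : q),
-- representing p/q (and ∞ when q = 0).  The Möbius map
-- f(x) = (d x + k)/(x + d) acts by (p : q) ↦ (d p + k q : p + d q);
-- in particular f(∞) = f(1 : 0) = (d : 1) = d.
fAct : ℕ → ℕ → ℕ × ℕ → ℕ × ℕ
fAct k d (p , q) = (d * p + k * q , p + d * q)

orbit : ℕ → ℕ → ℕ → ℕ × ℕ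
orbit k d zero = (1 , 0)
orbit k d (suc n) = fAct k d (orbit k d n)

-- "f^n(∞) = p/q" (q > 0): cross-multiplied equality of projective points
OrbitHits : ℕ → ℕ → ℕ → ℕ → ℕ → Set
OrbitHits k d n p q = p * proj₂ (orbit k d n) ≡ q * proj₁ (orbit k d n)

{-# OPTIONS --safe #-}
-- Write a = |k − d²|. From a ∣ (2d)² one gets a = A² h and 2d = A h E, hence 4k = A² δ with
-- δ = h (h E² ± 4), and a Pellian p/q of √k yields the solution (2p, qA) of x² − δ y² = ±4.
-- The map f is multiplication by d + √k on homogeneous coordinates; for h = 1 this is A times
-- the unit ε = (E + √δ)/2, and for h ≥ 2 its square is a multiple of ε = (h E² ± 2 + E √δ)/2.
-- So f (resp. f²) takes the point A x / (2y) of a solution to that of ε (x + y √δ)/2, and the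
-- orbit of ∞ starts at the point of ε. When ε is the fundamental solution, descent (dividing by
-- ε lowers x) shows that every positive solution is a power of ε, so every Pellian convergent is
-- on the orbit. The excluded (k, d) are those where ε is the square of the fundamental unit
-- (1 + √5)/2 or 1 + √2: then only even powers are reached, and the Pellians coming from odd
-- powers are ruled out by the divisibility hypotheses on F and G.
module Submission where

open import Defs
open import Data.Nat using (ℕ; _+_; _*_; _≤_; _<_)
open import Data.Nat.Divisibility using (_∣_)
open import Data.Integer using (+_; _-_)
open import Data.Integer.Divisibility using () renaming (_∣_ to _∣ℤ_)
open import Data.Product using (Σ; ∃; ∃-syntax; _×_; _,_)
open import Data.Sum using (_⊎_)
open import Relation.Nullary using (¬_)
open import Relation.Binary.PropositionalEquality using (_≡_; _≢_)

open import Data.Nat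
open import Data.Nat.Properties
open import Data.Nat.Divisibility using (divides; quotient; m∣n⇒n≡quotient*m; n/m≡quotient; *-cancelʳ-∣)
open import Data.Nat.GCD using (gcd; gcd[m,n]∣m; gcd[m,n]∣n; gcd[m,n]≢0)
open import Data.Nat.Coprimality using (Coprime; coprime-/gcd; coprime-divisor)
open import Data.Nat.Induction using (<-rec)
open import Data.Nat.Tactic.RingSolver using (solve; solve-∀)
open import Data.Integer using (∣_∣)
import Data.Integer.Properties as ℤ
open import Data.List using (_∷_; [])
open import Data.Product
open import Data.Sum
open import Data.Empty using (⊥-elim)
open import Relation.Nullary using (yes; no)
open import Relation.Nullary.Decidable using (from-yes; _×-dec_)
open import Relation.Binary.Definitions using (tri<; tri≈; tri>)
open import Relation.Binary.PropositionalEquality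

square-mono-≤ : ∀ {m n} → m ≤ n → m * m ≤ n * n
square-mono-≤ m≤n = *-mono-≤ m≤n m≤n

square-mono-< : ∀ {m n} → m < n → m * m < n * n
square-mono-< m<n = *-mono-< m<n m<n

square-cancel-< : ∀ m n → m * m < n * n → m < n
square-cancel-< m n mm<nn = ≰⇒> λ n≤m → <⇒≱ mm<nn (square-mono-≤ n≤m)

square-cancel-≤ : ∀ m n → m * m ≤ n * n → m ≤ n
square-cancel-≤ m n mm≤nn = ≮⇒≥ λ n<m → <⇒≱ (square-mono-< n<m) mm≤nn

square-injective : ∀ m n → m * m ≡ n * n → m ≡ n
square-injective m n eq =
  ≤-antisym (square-cancel-≤ m n (≤-reflexive eq)) (square-cancel-≤ n m (≤-reflexive (sym eq)))

even-or-odd : ∀ n → ∃[ w ] (n ≡ 2 * w ⊎ n ≡ 1 + 2 * w)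
even-or-odd zero = 0 , inj₁ refl
even-or-odd (suc n) with even-or-odd n
... | w , inj₁ refl = w , inj₂ refl
... | w , inj₂ refl = suc w , inj₁ (solve (w ∷ []))

half-positive : ∀ {u w} → 1 ≤ u → u ≡ 2 * w → 1 ≤ w
half-positive {w = zero}  u≥1 refl = u≥1
half-positive {w = suc w} _   _    = s≤s z≤n

even-square⇒even : ∀ u X Y → u * u + 2 * X ≡ 2 * Y → ∃[ w ] u ≡ 2 * w
even-square⇒even u X Y eq with even-or-odd u
... | w , inj₁ u≡2w = w , u≡2w
... | w , inj₂ refl = ⊥-elim (even≢odd Y (2 * (w * w) + 2 * w + X) (sym (begin
  1 + 2 * (2 * (w * w) + 2 * w + X)  ≡⟨ solve (w ∷ X ∷ []) ⟩
  (1 + 2 * w) * (1 + 2 * w) + 2 * X  ≡⟨ eq ⟩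
  2 * Y                              ∎)))
  where open ≡-Reasoning

square-excess-even : ∀ A B a b → A * A + 2 * a ≡ B * B + 2 * b → a < b →
                     ∃[ w ] (1 ≤ w × A ≡ B + 2 * w)
square-excess-even A B a b eq a<b
  with m≤n⇒∃[o]m+o≡n (square-cancel-< B A B*B<A*A)
  where
  B*B<A*A : B * B < A * A
  B*B<A*A = +-cancelʳ-< (2 * a) (B * B) (A * A)
    (subst (B * B + 2 * a <_) (sym eq) (+-monoʳ-< (B * B) (*-monoʳ-< 2 a<b)))
... | o , refl with even-square⇒even (suc o) (suc o * B + a) b (+-cancelˡ-≡ (B * B) _ _ (begin
      B * B + (suc o * suc o + 2 * (suc o * B + a))  ≡⟨ solve (B ∷ o ∷ a ∷ []) ⟩
      (suc B + o) * (suc B + o) + 2 * a             ≡⟨ eq ⟩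
      B * B + 2 * b                                 ∎))
  where open ≡-Reasoning
...   | w , u≡2w = w , half-positive (s≤s z≤n) u≡2w , trans (sym (+-suc B o)) (cong (_+_ B) u≡2w)

square-gap : ∀ x z {T} → x * x ≡ z * z + 4 * T → 1 ≤ T → ∃[ j ] (1 ≤ j × x ≡ z + 2 * j × T ≡ z * j + j * j)
square-gap x z {T} eq T≥1 with square-excess-even x z 0 (2 * T) squares (*-monoʳ-< 2 T≥1)
  where
  squares : x * x + 2 * 0 ≡ z * z + 2 * (2 * T)
  squares = trans (+-identityʳ (x * x)) (trans eq (cong (_+_ (z * z)) (solve (T ∷ []))))
... | j , j≥1 , x≡z+2j = j , j≥1 , x≡z+2j , *-cancelˡ-≡ _ _ 4 (+-cancelˡ-≡ (z * z) _ _ (begin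
  z * z + 4 * T                ≡⟨ sym eq ⟩
  x * x                        ≡⟨ cong (λ t → t * t) x≡z+2j ⟩
  (z + 2 * j) * (z + 2 * j)    ≡⟨ solve (z ∷ j ∷ []) ⟩
  z * z + 4 * (z * j + j * j)  ∎))
  where open ≡-Reasoning

square-gap-lower : ∀ x z {T} → x * x ≡ z * z + 4 * T → 1 ≤ T → z < T
square-gap-lower x z {T} eq T≥1 =
  let j , j≥1 , _ , T≡zj+j² = square-gap x z eq T≥1
  in begin-strict
    z                ≡⟨ sym (*-identityʳ z) ⟩
    z * 1            <⟨ m<m+n (z * 1) (*-mono-≤ j≥1 j≥1) ⟩
    z * 1 + j * j    ≤⟨ +-monoˡ-≤ (j * j) (*-monoʳ-≤ z j≥1) ⟩
    z * j + j * j    ≡⟨ sym T≡zj+j² ⟩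
    T                ∎
  where open ≤-Reasoning

linear≤quadratic : ∀ {x j} → 1 ≤ x → 1 ≤ j → x + 2 * j ≤ x * j + j * j + 1
linear≤quadratic {suc a} {suc b} _ _ = ≤-trans (m≤m+n _ (b + a * b + b * b)) (≤-reflexive (expand a b))
  where
  expand : ∀ a b → (1 + a) + 2 * (1 + b) + (b + a * b + b * b) ≡ (1 + a) * (1 + b) + (1 + b) * (1 + b) + 1
  expand = solve-∀

square-gap-upper : ∀ x z {T} → x * x + 4 * T ≡ z * z → 1 ≤ x → 1 ≤ T → z ≤ T + 1
square-gap-upper x z eq x≥1 T≥1 =
  let j , j≥1 , z≡x+2j , T≡xj+j² = square-gap z x (sym eq) T≥1
  in subst₂ _≤_ (sym z≡x+2j) (cong (_+ 1) (sym T≡xj+j²)) (linear≤quadratic x≥1 j≥1)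

square+8≡square⇒3 : ∀ {x c} → x * x + 8 ≡ c * c → 1 ≤ x → c ≡ 3
square+8≡square⇒3 {x} {c} eq x≥1 = ≤-antisym (square-gap-upper x c {2} eq x≥1 (s≤s z≤n))
  (square-cancel-≤ 3 c (subst (9 ≤_) eq (+-monoˡ-≤ 8 (*-mono-≤ x≥1 x≥1))))

square≢5 : ∀ E → E * E ≢ 5
square≢5 E eq = <⇒≱ (square-cancel-< E 3 (subst (_< 9) (sym eq) (from-yes (5 <? 9))))
                    (square-cancel-< 2 E (subst (4 <_) (sym eq) (from-yes (4 <? 5))))

norm+4≢norm-4 : ∀ c {t} → c * c ≡ t + 4 → c * c + 4 ≢ t
norm+4≢norm-4 c {t} hc eq = m≢1+m+n t (begin
  t                ≡⟨ sym eq ⟩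
  c * c + 4        ≡⟨ cong (_+ 4) hc ⟩
  t + 4 + 4        ≡⟨ solve (t ∷ []) ⟩
  suc (t + 7)      ∎)
  where open ≡-Reasoning

record SquareFactorisation (a e : ℕ) : Set where
  constructor factorisation
  field
    A h E : ℕ
    A≥1   : 1 ≤ A
    h≥1   : 1 ≤ h
    E≥1   : 1 ≤ E
    a≡A²h : a ≡ A * A * h
    e≡AhE : e ≡ A * h * E

-- With g = gcd a e, A = a / g is coprime to e / g and divides (e / g)² g, hence divides g = h A.
square-divisor-split : ∀ {a e} → 1 ≤ a → 1 ≤ e → a ∣ e * e → SquareFactorisation a e
square-divisor-split {a} {e} a≥1 e≥1 a∣e² = factorisation A h E A≥1 h≥1 E≥1 a≡A²h e≡AhE
  where
  open ≡-Reasoning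
  rearrange : ∀ E g → (E * g) * (E * g) ≡ E * (E * g) * g
  rearrange = solve-∀
  square-times : ∀ A h → A * (h * A) ≡ A * A * h
  square-times = solve-∀
  times-square : ∀ E h A → E * (h * A) ≡ A * h * E
  times-square = solve-∀
  a≢0 : a ≢ 0
  a≢0 = m<n⇒n≢0 a≥1
  g = gcd a e
  g≢0 : g ≢ 0
  g≢0 = gcd[m,n]≢0 a e (inj₁ a≢0)
  instance
    g-nonZero : NonZero g
    g-nonZero = ≢-nonZero g≢0
  A = quotient (gcd[m,n]∣m a e)
  E = quotient (gcd[m,n]∣n a e)
  a≡Ag : a ≡ A * g
  a≡Ag = m∣n⇒n≡quotient*m (gcd[m,n]∣m a e)
  e≡Eg : e ≡ E * g
  e≡Eg = m∣n⇒n≡quotient*m (gcd[m,n]∣n a e)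
  A⊥E : Coprime A E
  A⊥E = subst₂ Coprime (n/m≡quotient (gcd[m,n]∣m a e)) (n/m≡quotient (gcd[m,n]∣n a e)) (coprime-/gcd a e)
  A∣g : A ∣ g
  A∣g = coprime-divisor A⊥E (coprime-divisor A⊥E (*-cancelʳ-∣ g (subst₂ _∣_ a≡Ag (begin
    e * e              ≡⟨ cong₂ _*_ e≡Eg e≡Eg ⟩
    (E * g) * (E * g)  ≡⟨ rearrange E g ⟩
    E * (E * g) * g    ∎) a∣e²)))
  h = quotient A∣g
  g≡hA : g ≡ h * A
  g≡hA = m∣n⇒n≡quotient*m A∣g
  a≡A²h : a ≡ A * A * h
  a≡A²h = trans a≡Ag (trans (cong (A *_) g≡hA) (square-times A h))
  e≡AhE : e ≡ A * h * E
  e≡AhE = trans e≡Eg (trans (cong (E *_) g≡hA) (times-square E h A))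
  A≥1 : 1 ≤ A
  A≥1 = n≢0⇒n>0 λ A≡0 → a≢0 (trans a≡Ag (cong (_* g) A≡0))
  h≥1 : 1 ≤ h
  h≥1 = n≢0⇒n>0 λ h≡0 → g≢0 (trans g≡hA (cong (_* A) h≡0))
  E≥1 : 1 ≤ E
  E≥1 = n≢0⇒n>0 λ E≡0 → m<n⇒n≢0 e≥1 (trans e≡Eg (cong (_* g) E≡0))

data PellFour (δ x y : ℕ) : Set where
  norm+4 : x * x ≡ δ * (y * y) + 4 → PellFour δ x y
  norm-4 : x * x + 4 ≡ δ * (y * y) → PellFour δ x y

-- (x + y √δ)/2 = (c + f √δ)/2 · (x' + y' √δ)/2
record UnitStep (δ c f x' y' x y : ℕ) : Set where
  constructor unitStep
  field
    x-step : 2 * x ≡ c * x' + δ * f * y'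
    y-step : 2 * y ≡ f * x' + c * y'

-- The norm is multiplicative, N(c + f√δ) N(x + y√δ) = N((c + f√δ)(x + y√δ)),
-- with every term moved to the side where it is positive.
brahmagupta : ∀ δ c f x y →
  (c * x + δ * f * y) * (c * x + δ * f * y) + δ * (f * f) * (x * x) + δ * (c * c) * (y * y)
  ≡ δ * ((f * x + c * y) * (f * x + c * y)) + (c * c) * (x * x) + δ * (δ * (f * f)) * (y * y)
brahmagupta = solve-∀

module _ {δ c f x y x' y' : ℕ} where
  open ≡-Reasoning

  unitStep-from⁺ : c * c ≡ δ * (f * f) + 4 →
                   c * x ≡ δ * f * y + 2 * x' → c * y ≡ f * x + 2 * y' → UnitStep δ c f x' y' x y
  unitStep-from⁺ hc hx hy = unitStep (*-cancelˡ-≡ _ _ 2 (+-cancelʳ-≡ (c * (δ * f * y) + δ * f * (f * x)) _ _ (begin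
      2 * (2 * x) + (c * (δ * f * y) + δ * f * (f * x))  ≡⟨ solve (δ ∷ c ∷ f ∷ x ∷ y ∷ []) ⟩
      (δ * (f * f) + 4) * x + δ * f * (c * y)             ≡⟨ cong (λ t → t * x + δ * f * (c * y)) (sym hc) ⟩
      (c * c) * x + δ * f * (c * y)                       ≡⟨ cong (_+ δ * f * (c * y)) (*-assoc c c x) ⟩
      c * (c * x) + δ * f * (c * y)                       ≡⟨ cong₂ (λ u v → c * u + δ * f * v) hx hy ⟩
      c * (δ * f * y + 2 * x') + δ * f * (f * x + 2 * y') ≡⟨ solve (δ ∷ c ∷ f ∷ x ∷ y ∷ x' ∷ y' ∷ []) ⟩
      2 * (c * x' + δ * f * y') + (c * (δ * f * y) + δ * f * (f * x)) ∎)))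
    (*-cancelˡ-≡ _ _ 2 (+-cancelʳ-≡ (f * (δ * f * y) + c * (f * x)) _ _ (begin
      2 * (2 * y) + (f * (δ * f * y) + c * (f * x))       ≡⟨ solve (δ ∷ c ∷ f ∷ x ∷ y ∷ []) ⟩
      f * (c * x) + (δ * (f * f) + 4) * y                 ≡⟨ cong (λ t → f * (c * x) + t * y) (sym hc) ⟩
      f * (c * x) + (c * c) * y                           ≡⟨ cong (_+_ (f * (c * x))) (*-assoc c c y) ⟩
      f * (c * x) + c * (c * y)                           ≡⟨ cong₂ (λ u v → f * u + c * v) hx hy ⟩
      f * (δ * f * y + 2 * x') + c * (f * x + 2 * y')     ≡⟨ solve (δ ∷ c ∷ f ∷ x ∷ y ∷ x' ∷ y' ∷ []) ⟩
      2 * (f * x' + c * y') + (f * (δ * f * y) + c * (f * x)) ∎)))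

  unitStep-from⁻ : c * c + 4 ≡ δ * (f * f) →
                   δ * f * y ≡ c * x + 2 * x' → f * x ≡ c * y + 2 * y' → UnitStep δ c f x' y' x y
  unitStep-from⁻ hc hx hy = unitStep (*-cancelˡ-≡ _ _ 2 (+-cancelʳ-≡ (c * (c * x) + δ * f * (c * y)) _ _ (begin
      2 * (2 * x) + (c * (c * x) + δ * f * (c * y))       ≡⟨ solve (δ ∷ c ∷ f ∷ x ∷ y ∷ []) ⟩
      c * (δ * f * y) + (c * c + 4) * x                   ≡⟨ cong (λ t → c * (δ * f * y) + t * x) hc ⟩
      c * (δ * f * y) + δ * (f * f) * x                   ≡⟨ cong (_+_ (c * (δ * f * y))) (solve (δ ∷ f ∷ x ∷ [])) ⟩
      c * (δ * f * y) + δ * f * (f * x)                   ≡⟨ cong₂ (λ u v → c * u + δ * f * v) hx hy ⟩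
      c * (c * x + 2 * x') + δ * f * (c * y + 2 * y')     ≡⟨ solve (δ ∷ c ∷ f ∷ x ∷ y ∷ x' ∷ y' ∷ []) ⟩
      2 * (c * x' + δ * f * y') + (c * (c * x) + δ * f * (c * y)) ∎)))
    (*-cancelˡ-≡ _ _ 2 (+-cancelʳ-≡ (f * (c * x) + c * (c * y)) _ _ (begin
      2 * (2 * y) + (f * (c * x) + c * (c * y))           ≡⟨ solve (c ∷ f ∷ x ∷ y ∷ []) ⟩
      (c * c + 4) * y + c * (f * x)                       ≡⟨ cong (λ t → t * y + c * (f * x)) hc ⟩
      δ * (f * f) * y + c * (f * x)                       ≡⟨ cong (_+ c * (f * x)) (solve (δ ∷ f ∷ y ∷ [])) ⟩
      f * (δ * f * y) + c * (f * x)                       ≡⟨ cong₂ (λ u v → f * u + c * v) hx hy ⟩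
      f * (c * x + 2 * x') + c * (c * y + 2 * y')         ≡⟨ solve (c ∷ f ∷ x ∷ y ∷ x' ∷ y' ∷ []) ⟩
      2 * (f * x' + c * y') + (f * (c * x) + c * (c * y)) ∎)))

  norm-transfer⁺ : UnitStep δ c f x' y' x y → c * c ≡ δ * (f * f) + 4 →
                   x * x + δ * (y' * y') ≡ δ * (y * y) + x' * x'
  norm-transfer⁺ (unitStep hx hy) hc = *-cancelˡ-≡ _ _ 4 (+-cancelʳ-≡ (δ * (f * f) * (x' * x') + δ * (δ * (f * f)) * (y' * y')) _ _ (begin
      4 * (x * x + δ * (y' * y')) + (δ * (f * f) * (x' * x') + δ * (δ * (f * f)) * (y' * y'))
        ≡⟨ solve (δ ∷ f ∷ x ∷ x' ∷ y' ∷ []) ⟩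
      (2 * x) * (2 * x) + δ * (f * f) * (x' * x') + δ * (δ * (f * f) + 4) * (y' * y')
        ≡⟨ cong₂ (λ u v → u * u + δ * (f * f) * (x' * x') + δ * v * (y' * y')) hx (sym hc) ⟩
      (c * x' + δ * f * y') * (c * x' + δ * f * y') + δ * (f * f) * (x' * x') + δ * (c * c) * (y' * y')
        ≡⟨ brahmagupta δ c f x' y' ⟩
      δ * ((f * x' + c * y') * (f * x' + c * y')) + (c * c) * (x' * x') + δ * (δ * (f * f)) * (y' * y')
        ≡⟨ cong₂ (λ u v → δ * (u * u) + v * (x' * x') + δ * (δ * (f * f)) * (y' * y')) (sym hy) hc ⟩
      δ * ((2 * y) * (2 * y)) + (δ * (f * f) + 4) * (x' * x') + δ * (δ * (f * f)) * (y' * y')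
        ≡⟨ solve (δ ∷ f ∷ y ∷ x' ∷ y' ∷ []) ⟩
      4 * (δ * (y * y) + x' * x') + (δ * (f * f) * (x' * x') + δ * (δ * (f * f)) * (y' * y')) ∎))

  norm-transfer⁻ : UnitStep δ c f x' y' x y → c * c + 4 ≡ δ * (f * f) →
                   x * x + x' * x' ≡ δ * (y * y) + δ * (y' * y')
  norm-transfer⁻ (unitStep hx hy) hc = *-cancelˡ-≡ _ _ 4 (+-cancelʳ-≡ ((c * c) * (x' * x') + δ * (c * c) * (y' * y')) _ _ (begin
      4 * (x * x + x' * x') + ((c * c) * (x' * x') + δ * (c * c) * (y' * y'))
        ≡⟨ solve (δ ∷ c ∷ x ∷ x' ∷ y' ∷ []) ⟩
      (2 * x) * (2 * x) + (c * c + 4) * (x' * x') + δ * (c * c) * (y' * y')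
        ≡⟨ cong₂ (λ u v → u * u + v * (x' * x') + δ * (c * c) * (y' * y')) hx hc ⟩
      (c * x' + δ * f * y') * (c * x' + δ * f * y') + δ * (f * f) * (x' * x') + δ * (c * c) * (y' * y')
        ≡⟨ brahmagupta δ c f x' y' ⟩
      δ * ((f * x' + c * y') * (f * x' + c * y')) + (c * c) * (x' * x') + δ * (δ * (f * f)) * (y' * y')
        ≡⟨ cong₂ (λ u v → δ * (u * u) + (c * c) * (x' * x') + δ * v * (y' * y')) (sym hy) (sym hc) ⟩
      δ * ((2 * y) * (2 * y)) + (c * c) * (x' * x') + δ * (c * c + 4) * (y' * y')
        ≡⟨ solve (δ ∷ c ∷ y ∷ x' ∷ y' ∷ []) ⟩
      4 * (δ * (y * y) + δ * (y' * y')) + ((c * c) * (x' * x') + δ * (c * c) * (y' * y')) ∎))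

module _ {δ x y x' y' : ℕ} where
  open ≡-Reasoning

  pellFour-transfer⁺ : x * x + δ * (y' * y') ≡ δ * (y * y) + x' * x' → PellFour δ x y → PellFour δ x' y'
  pellFour-transfer⁺ eq (norm+4 hx) = norm+4 (+-cancelˡ-≡ (δ * (y * y)) _ _ (begin
    δ * (y * y) + x' * x'            ≡⟨ sym eq ⟩
    x * x + δ * (y' * y')            ≡⟨ cong (_+ δ * (y' * y')) hx ⟩
    δ * (y * y) + 4 + δ * (y' * y')  ≡⟨ solve (δ ∷ y ∷ y' ∷ []) ⟩
    δ * (y * y) + (δ * (y' * y') + 4) ∎))
  pellFour-transfer⁺ eq (norm-4 hx) = norm-4 (+-cancelˡ-≡ (δ * (y * y)) _ _ (begin
    δ * (y * y) + (x' * x' + 4)      ≡⟨ solve (δ ∷ y ∷ x' ∷ []) ⟩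
    δ * (y * y) + x' * x' + 4        ≡⟨ cong (_+ 4) (sym eq) ⟩
    x * x + δ * (y' * y') + 4        ≡⟨ solve (δ ∷ x ∷ y' ∷ []) ⟩
    (x * x + 4) + δ * (y' * y')      ≡⟨ cong (_+ δ * (y' * y')) hx ⟩
    δ * (y * y) + δ * (y' * y')      ∎))

  pellFour-transfer⁻ : x * x + x' * x' ≡ δ * (y * y) + δ * (y' * y') → PellFour δ x y → PellFour δ x' y'
  pellFour-transfer⁻ eq (norm+4 hx) = norm-4 (+-cancelˡ-≡ (δ * (y * y)) _ _ (begin
    δ * (y * y) + (x' * x' + 4)      ≡⟨ solve (δ ∷ y ∷ x' ∷ []) ⟩
    (δ * (y * y) + 4) + x' * x'      ≡⟨ cong (_+ x' * x') (sym hx) ⟩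
    x * x + x' * x'                  ≡⟨ eq ⟩
    δ * (y * y) + δ * (y' * y')      ∎))
  pellFour-transfer⁻ eq (norm-4 hx) = norm+4 (+-cancelˡ-≡ (x * x) _ _ (begin
    x * x + x' * x'                  ≡⟨ eq ⟩
    δ * (y * y) + δ * (y' * y')      ≡⟨ cong (_+ δ * (y' * y')) (sym hx) ⟩
    x * x + 4 + δ * (y' * y')        ≡⟨ solve (x ∷ δ ∷ y' ∷ []) ⟩
    x * x + (δ * (y' * y') + 4)      ∎))

square≡+4⇒2≤ : ∀ c a → c * c ≡ a + 4 → 2 ≤ c
square≡+4⇒2≤ c a eq = square-cancel-≤ 2 c (subst (4 ≤_) (sym eq) (m≤n+m 4 a))

pellFour-bound : ∀ {δ x y} → PellFour δ x y → x * x ≤ δ * (y * y) + 4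
pellFour-bound (norm+4 hx) = ≤-reflexive hx
pellFour-bound {x = x} (norm-4 hx) = ≤-trans (m≤m+n (x * x) 4) (≤-trans (≤-reflexive hx) (m≤m+n _ 4))

x'<x⁺ : ∀ {δ c f x y x' y'} → 2 ≤ c → 1 ≤ δ * f * y' → UnitStep δ c f x' y' x y → x' < x
x'<x⁺ {x' = x'} c≥2 pos (unitStep hx _) = *-cancelˡ-< 2 x' _
  (subst₂ _<_ (+-identityʳ (2 * x')) (sym hx) (+-mono-≤-< (*-monoˡ-≤ x' c≥2) pos))

x'<x⁻ : ∀ {δ c f x y x' y'} → 5 ≤ δ → 1 ≤ c → 1 ≤ f → 1 ≤ y' → PellFour δ x' y' →
        UnitStep δ c f x' y' x y → x' < x
x'<x⁻ {δ} {f = f} {x} {x' = x'} {y'} δ≥5 c≥1 f≥1 y'≥1 s (unitStep hx _) = *-cancelˡ-< 2 x' x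
  (subst₂ _<_ x'+x'≡2x' (sym hx) (+-mono-≤-< (*-monoˡ-≤ x' c≥1) x'<δfy'))
  where
  open ≤-Reasoning
  x'+x'≡2x' : 1 * x' + x' ≡ 2 * x'
  x'+x'≡2x' = solve (x' ∷ [])
  δy'y'≥5 : 5 ≤ δ * (y' * y')
  δy'y'≥5 = *-mono-≤ δ≥5 (*-mono-≤ y'≥1 y'≥1)
  x'<δfy' : x' < δ * f * y'
  x'<δfy' = square-cancel-< x' (δ * f * y') (begin-strict
    x' * x'                              ≤⟨ pellFour-bound s ⟩
    δ * (y' * y') + 4                    <⟨ +-monoʳ-< (δ * (y' * y')) (≤-trans (from-yes (4 <? 20)) (*-monoʳ-≤ 4 δy'y'≥5)) ⟩
    δ * (y' * y') + 4 * (δ * (y' * y'))  ≡⟨ solve (δ ∷ y' ∷ []) ⟩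
    5 * (δ * (y' * y'))                  ≤⟨ *-monoˡ-≤ (δ * (y' * y')) (*-mono-≤ δ≥5 (*-mono-≤ f≥1 f≥1)) ⟩
    (δ * (f * f)) * (δ * (y' * y'))      ≡⟨ solve (δ ∷ f ∷ y' ∷ []) ⟩
    (δ * f * y') * (δ * f * y')          ∎)

δf²+4<δy² : ∀ {δ f y} → 2 ≤ δ → 1 ≤ f → f < y → δ * (f * f) + 4 < δ * (y * y)
δf²+4<δy² {δ} {f} {y} δ≥2 f≥1 f<y = begin-strict
  δ * (f * f) + 4                 <⟨ +-monoʳ-< (δ * (f * f)) (≤-trans (n≤1+n 5) (+-mono-≤ δ≥2 (*-monoʳ-≤ 2 (*-mono-≤ δ≥2 f≥1)))) ⟩
  δ * (f * f) + (δ + 2 * (δ * f)) ≡⟨ solve (δ ∷ f ∷ []) ⟩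
  δ * (suc f * suc f)             ≤⟨ *-monoʳ-≤ δ (square-mono-≤ f<y) ⟩
  δ * (y * y)                     ∎
  where open ≤-Reasoning

record Predecessor (δ c f x y : ℕ) : Set where
  constructor predecessor
  field
    x' y'    : ℕ
    x'≥1     : 1 ≤ x'
    y'≥1     : 1 ≤ y'
    x'<x     : x' < x
    solution : PellFour δ x' y'
    step     : UnitStep δ c f x' y' x y

module _ {δ c f x y : ℕ} where
  open ≡-Reasoning

  predecessor⁺ : ∀ {x' y'} → c * c ≡ δ * (f * f) + 4 → 1 ≤ δ → 1 ≤ f → PellFour δ x y → 1 ≤ x' → 1 ≤ y' →
                 c * x ≡ δ * f * y + 2 * x' → c * y ≡ f * x + 2 * y' → Predecessor δ c f x y
  predecessor⁺ {x'} {y'} hc δ≥1 f≥1 s x'≥1 y'≥1 hx hy = predecessor x' y' x'≥1 y'≥1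
    (x'<x⁺ (square≡+4⇒2≤ c _ hc) (*-mono-≤ (*-mono-≤ δ≥1 f≥1) y'≥1) step)
    (pellFour-transfer⁺ (norm-transfer⁺ step hc) s) step
    where
    step : UnitStep δ c f x' y' x y
    step = unitStep-from⁺ hc hx hy

  predecessor⁻ : ∀ {x' y'} → c * c + 4 ≡ δ * (f * f) → 5 ≤ δ → 1 ≤ c → 1 ≤ f → PellFour δ x y → 1 ≤ x' → 1 ≤ y' →
                 δ * f * y ≡ c * x + 2 * x' → f * x ≡ c * y + 2 * y' → Predecessor δ c f x y
  predecessor⁻ {x'} {y'} hc δ≥5 c≥1 f≥1 s x'≥1 y'≥1 hx hy = predecessor x' y' x'≥1 y'≥1
    (x'<x⁻ δ≥5 c≥1 f≥1 y'≥1 solution step) solution step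
    where
    step : UnitStep δ c f x' y' x y
    step = unitStep-from⁻ hc hx hy
    solution : PellFour δ x' y'
    solution = pellFour-transfer⁻ (norm-transfer⁻ step hc) s

  -- In each sign case the coordinates |c x − δ f y|/2 and |c y − f x|/2 of ε⁻¹ (x + y √δ)/2
  -- are read off an identity between squares by square-excess-even.
  predecessor⁺⁺ : 1 ≤ δ → 1 ≤ f → c * c ≡ δ * (f * f) + 4 → x * x ≡ δ * (y * y) + 4 → f < y →
                   Predecessor δ c f x y
  predecessor⁺⁺ δ≥1 f≥1 hc hx f<y =
    let x' , x'≥1 , ex = square-excess-even (c * x) (δ * f * y) 0 (2 * (4 + δ * (y * y) + δ * (f * f))) squares-x (s≤s z≤n)
        y' , y'≥1 , ey = square-excess-even (c * y) (f * x) _ _ squares-y (*-monoʳ-< 2 (square-mono-< f<y))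
    in predecessor⁺ hc δ≥1 f≥1 (norm+4 hx) x'≥1 y'≥1 ex ey
    where
    squares-x : (c * x) * (c * x) + 2 * 0 ≡ (δ * f * y) * (δ * f * y) + 2 * (2 * (4 + δ * (y * y) + δ * (f * f)))
    squares-x = begin
      (c * x) * (c * x) + 2 * 0              ≡⟨ solve (c ∷ x ∷ []) ⟩
      (c * c) * (x * x)                      ≡⟨ cong₂ _*_ hc hx ⟩
      (δ * (f * f) + 4) * (δ * (y * y) + 4)  ≡⟨ solve (δ ∷ f ∷ y ∷ []) ⟩
      (δ * f * y) * (δ * f * y) + 2 * (2 * (4 + δ * (y * y) + δ * (f * f))) ∎
    squares-y : (c * y) * (c * y) + 2 * (2 * (f * f)) ≡ (f * x) * (f * x) + 2 * (2 * (y * y))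
    squares-y = begin
      (c * y) * (c * y) + 2 * (2 * (f * f))  ≡⟨ solve (c ∷ f ∷ y ∷ []) ⟩
      (c * c) * (y * y) + 4 * (f * f)        ≡⟨ cong (λ t → t * (y * y) + 4 * (f * f)) hc ⟩
      (δ * (f * f) + 4) * (y * y) + 4 * (f * f) ≡⟨ solve (δ ∷ f ∷ y ∷ []) ⟩
      (f * f) * (δ * (y * y) + 4) + 4 * (y * y) ≡⟨ cong (λ t → (f * f) * t + 4 * (y * y)) (sym hx) ⟩
      (f * f) * (x * x) + 4 * (y * y)        ≡⟨ solve (f ∷ x ∷ y ∷ []) ⟩
      (f * x) * (f * x) + 2 * (2 * (y * y))  ∎

  predecessor⁺⁻ : 2 ≤ δ → 1 ≤ f → c * c ≡ δ * (f * f) + 4 → x * x + 4 ≡ δ * (y * y) → f < y →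
                   Predecessor δ c f x y
  predecessor⁺⁻ δ≥2 f≥1 hc hx f<y =
    let x' , x'≥1 , ex = square-excess-even (c * x) (δ * f * y) _ _ squares-x (*-monoʳ-< 2 c²<δy²)
        y' , y'≥1 , ey = square-excess-even (c * y) (f * x) 0 _ squares-y
                           (*-monoʳ-< 2 (≤-trans (*-mono-≤ f≥1 f≥1) (m≤m+n (f * f) (y * y))))
    in predecessor⁺ hc (≤-trans (s≤s z≤n) δ≥2) f≥1 (norm-4 hx) x'≥1 y'≥1 ex ey
    where
    c²<δy² : c * c < δ * (y * y)
    c²<δy² = subst (_< δ * (y * y)) (sym hc) (δf²+4<δy² δ≥2 f≥1 f<y)
    squares-x : (c * x) * (c * x) + 2 * (2 * (c * c)) ≡ (δ * f * y) * (δ * f * y) + 2 * (2 * (δ * (y * y)))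
    squares-x = begin
      (c * x) * (c * x) + 2 * (2 * (c * c))  ≡⟨ solve (c ∷ x ∷ []) ⟩
      (c * c) * (x * x + 4)                  ≡⟨ cong ((c * c) *_) hx ⟩
      (c * c) * (δ * (y * y))                ≡⟨ cong (_* (δ * (y * y))) hc ⟩
      (δ * (f * f) + 4) * (δ * (y * y))      ≡⟨ solve (δ ∷ f ∷ y ∷ []) ⟩
      (δ * f * y) * (δ * f * y) + 2 * (2 * (δ * (y * y))) ∎
    squares-y : (c * y) * (c * y) + 2 * 0 ≡ (f * x) * (f * x) + 2 * (2 * (f * f + y * y))
    squares-y = begin
      (c * y) * (c * y) + 2 * 0              ≡⟨ solve (c ∷ y ∷ []) ⟩
      (c * c) * (y * y)                      ≡⟨ cong (_* (y * y)) hc ⟩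
      (δ * (f * f) + 4) * (y * y)            ≡⟨ solve (δ ∷ f ∷ y ∷ []) ⟩
      (f * f) * (δ * (y * y)) + 4 * (y * y)  ≡⟨ cong (λ t → (f * f) * t + 4 * (y * y)) (sym hx) ⟩
      (f * f) * (x * x + 4) + 4 * (y * y)    ≡⟨ solve (f ∷ x ∷ y ∷ []) ⟩
      (f * x) * (f * x) + 2 * (2 * (f * f + y * y)) ∎

  predecessor⁻⁺ : 5 ≤ δ → 1 ≤ c → 1 ≤ f → c * c + 4 ≡ δ * (f * f) → x * x ≡ δ * (y * y) + 4 → f ≤ y →
                   Predecessor δ c f x y
  predecessor⁻⁺ δ≥5 c≥1 f≥1 hc hx f≤y =
    let x' , x'≥1 , ex = square-excess-even (δ * f * y) (c * x) _ _ squares-x (*-monoʳ-< 2 c²<δy²)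
        y' , y'≥1 , ey = square-excess-even (f * x) (c * y) 0 _ squares-y
                           (*-monoʳ-< 2 (≤-trans (*-mono-≤ f≥1 f≥1) (m≤m+n (f * f) (y * y))))
    in predecessor⁻ hc δ≥5 c≥1 f≥1 (norm+4 hx) x'≥1 y'≥1 ex ey
    where
    c²<δy² : c * c < δ * (y * y)
    c²<δy² = <-≤-trans (m<m+n (c * c) (s≤s z≤n)) (subst (_≤ δ * (y * y)) (sym hc) (*-monoʳ-≤ δ (square-mono-≤ f≤y)))
    squares-x : (δ * f * y) * (δ * f * y) + 2 * (2 * (c * c)) ≡ (c * x) * (c * x) + 2 * (2 * (δ * (y * y)))
    squares-x = begin
      (δ * f * y) * (δ * f * y) + 2 * (2 * (c * c))    ≡⟨ solve (δ ∷ c ∷ f ∷ y ∷ []) ⟩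
      (δ * (f * f)) * (δ * (y * y)) + 4 * (c * c)      ≡⟨ cong (λ t → t * (δ * (y * y)) + 4 * (c * c)) (sym hc) ⟩
      (c * c + 4) * (δ * (y * y)) + 4 * (c * c)        ≡⟨ solve (δ ∷ c ∷ y ∷ []) ⟩
      (c * c) * (δ * (y * y) + 4) + 4 * (δ * (y * y))  ≡⟨ cong (λ t → (c * c) * t + 4 * (δ * (y * y))) (sym hx) ⟩
      (c * c) * (x * x) + 4 * (δ * (y * y))            ≡⟨ solve (δ ∷ c ∷ x ∷ y ∷ []) ⟩
      (c * x) * (c * x) + 2 * (2 * (δ * (y * y)))      ∎
    squares-y : (f * x) * (f * x) + 2 * 0 ≡ (c * y) * (c * y) + 2 * (2 * (f * f + y * y))
    squares-y = begin
      (f * x) * (f * x) + 2 * 0                  ≡⟨ solve (f ∷ x ∷ []) ⟩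
      (f * f) * (x * x)                          ≡⟨ cong ((f * f) *_) hx ⟩
      (f * f) * (δ * (y * y) + 4)                ≡⟨ solve (δ ∷ f ∷ y ∷ []) ⟩
      (δ * (f * f)) * (y * y) + 4 * (f * f)      ≡⟨ cong (λ t → t * (y * y) + 4 * (f * f)) (sym hc) ⟩
      (c * c + 4) * (y * y) + 4 * (f * f)        ≡⟨ solve (c ∷ f ∷ y ∷ []) ⟩
      (c * y) * (c * y) + 2 * (2 * (f * f + y * y)) ∎

  predecessor⁻⁻ : 5 ≤ δ → 1 ≤ c → 1 ≤ f → c * c + 4 ≡ δ * (f * f) → x * x + 4 ≡ δ * (y * y) → f < y →
                   Predecessor δ c f x y
  predecessor⁻⁻ δ≥5 c≥1 f≥1 hc hx f<y =
    let x' , x'≥1 , ex = square-excess-even (δ * f * y) (c * x) 0 (2 * (4 + c * c + x * x)) squares-x (s≤s z≤n)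
        y' , y'≥1 , ey = square-excess-even (f * x) (c * y) _ _ squares-y (*-monoʳ-< 2 (square-mono-< f<y))
    in predecessor⁻ hc δ≥5 c≥1 f≥1 (norm-4 hx) x'≥1 y'≥1 ex ey
    where
    squares-x : (δ * f * y) * (δ * f * y) + 2 * 0 ≡ (c * x) * (c * x) + 2 * (2 * (4 + c * c + x * x))
    squares-x = begin
      (δ * f * y) * (δ * f * y) + 2 * 0      ≡⟨ solve (δ ∷ f ∷ y ∷ []) ⟩
      (δ * (f * f)) * (δ * (y * y))          ≡⟨ cong₂ _*_ (sym hc) (sym hx) ⟩
      (c * c + 4) * (x * x + 4)              ≡⟨ solve (c ∷ x ∷ []) ⟩
      (c * x) * (c * x) + 2 * (2 * (4 + c * c + x * x)) ∎
    squares-y : (f * x) * (f * x) + 2 * (2 * (f * f)) ≡ (c * y) * (c * y) + 2 * (2 * (y * y))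
    squares-y = begin
      (f * x) * (f * x) + 2 * (2 * (f * f))  ≡⟨ solve (f ∷ x ∷ []) ⟩
      (f * f) * (x * x + 4)                  ≡⟨ cong ((f * f) *_) hx ⟩
      (f * f) * (δ * (y * y))                ≡⟨ solve (δ ∷ f ∷ y ∷ []) ⟩
      (δ * (f * f)) * (y * y)                ≡⟨ cong (_* (y * y)) (sym hc) ⟩
      (c * c + 4) * (y * y)                  ≡⟨ solve (c ∷ y ∷ []) ⟩
      (c * y) * (c * y) + 2 * (2 * (y * y))  ∎

-- The fundamental solution (c, f) of x² − δ y² = ±4, i.e. the least unit (c + f √δ)/2 of norm ±4.
record MinimalUnit (δ c f : ℕ) : Set where
  field
    δ≥2        : 2 ≤ δ
    c≥1        : 1 ≤ c
    f≥1        : 1 ≤ f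
    norm       : PellFour δ c f
    norm-4⇒δ≥5 : c * c + 4 ≡ δ * (f * f) → 5 ≤ δ
    minimal    : ∀ {x y} → 1 ≤ x → 1 ≤ y → PellFour δ x y → f ≤ y × (y ≡ f → c ≤ x)

module _ {δ c f : ℕ} (ε : MinimalUnit δ c f) where
  open MinimalUnit ε

  descend : ∀ {x y} → 1 ≤ x → 1 ≤ y → PellFour δ x y → (x ≡ c × y ≡ f) ⊎ Predecessor δ c f x y
  descend {x} {y} x≥1 y≥1 s with minimal x≥1 y≥1 s
  ... | f≤y , y≡f⇒c≤x with m≤n⇒m<n∨m≡n f≤y | norm | s
  ... | inj₁ f<y  | norm+4 hc | norm+4 hx = inj₂ (predecessor⁺⁺ (≤-trans (s≤s z≤n) δ≥2) f≥1 hc hx f<y)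
  ... | inj₁ f<y  | norm+4 hc | norm-4 hx = inj₂ (predecessor⁺⁻ δ≥2 f≥1 hc hx f<y)
  ... | _         | norm-4 hc | norm+4 hx = inj₂ (predecessor⁻⁺ (norm-4⇒δ≥5 hc) c≥1 f≥1 hc hx f≤y)
  ... | inj₁ f<y  | norm-4 hc | norm-4 hx = inj₂ (predecessor⁻⁻ (norm-4⇒δ≥5 hc) c≥1 f≥1 hc hx f<y)
  ... | inj₂ refl | norm+4 hc | norm+4 hx = inj₁ (square-injective x c (trans hx (sym hc)) , refl)
  ... | inj₂ refl | norm+4 hc | norm-4 hx = ⊥-elim (<⇒≱ x²<c² (square-mono-≤ (y≡f⇒c≤x refl)))
    where
    x²<c² : x * x < c * c
    x²<c² = subst (x * x <_) (sym (trans hc (cong (_+ 4) (sym hx))))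
              (<-≤-trans (m<m+n (x * x) (s≤s z≤n)) (m≤m+n (x * x + 4) 4))
  ... | inj₂ refl | norm-4 hc | norm-4 hx =
    inj₁ (square-injective x c (+-cancelʳ-≡ 4 _ _ (trans hx (sym hc))) , refl)

  unit-induction : (P : ℕ → ℕ → Set) → P c f →
                   (∀ {x' y' x y} → P x' y' → UnitStep δ c f x' y' x y → P x y) →
                   ∀ {x y} → 1 ≤ x → 1 ≤ y → PellFour δ x y → P x y
  unit-induction P base step {x} = <-rec (λ x → ∀ {y} → 1 ≤ x → 1 ≤ y → PellFour δ x y → P x y) go x
    where
    go : ∀ x → (∀ {x'} → x' < x → ∀ {y'} → 1 ≤ x' → 1 ≤ y' → PellFour δ x' y' → P x' y') →
         ∀ {y} → 1 ≤ x → 1 ≤ y → PellFour δ x y → P x y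
    go x rec x≥1 y≥1 s with descend x≥1 y≥1 s
    ... | inj₁ (refl , refl) = base
    ... | inj₂ (predecessor x' y' x'≥1 y'≥1 x'<x s' st) = step (rec x'<x x'≥1 y'≥1 s') st

scaled-≤ : ∀ h E y → 1 ≤ h → 1 ≤ y → h * E * y ≤ h * (y * y) → E ≤ y
scaled-≤ h E y h≥1 y≥1 le = *-cancelˡ-≤ (h * y) {{>-nonZero (*-mono-≤ h≥1 y≥1)}} (begin
  h * y * E    ≡⟨ solve (h ∷ y ∷ E ∷ []) ⟩
  h * E * y    ≤⟨ le ⟩
  h * (y * y)  ≡⟨ solve (h ∷ y ∷ []) ⟩
  h * y * y    ∎)
  where open ≤-Reasoning

scaled-< : ∀ h E y → h * E * y < h * (y * y) → E < y
scaled-< h E y lt = *-cancelˡ-< (h * y) E y (begin-strict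
  h * y * E    ≡⟨ solve (h ∷ y ∷ E ∷ []) ⟩
  h * E * y    <⟨ lt ⟩
  h * (y * y)  ≡⟨ solve (h ∷ y ∷ []) ⟩
  h * y * y    ∎)
  where open ≤-Reasoning

product≤2 : ∀ {h y} → 2 ≤ h → 1 ≤ y → h * y ≤ 2 → h ≡ 2 × y ≡ 1
product≤2 {h} {y} h≥2 y≥1 hy≤2 = h≡2 , ≤-antisym (*-cancelˡ-≤ 2 (subst (λ t → t * y ≤ 2 * 1) h≡2 hy≤2)) y≥1
  where
  h≡2 : h ≡ 2
  h≡2 = ≤-antisym (≤-trans (m≤m*n h y {{>-nonZero y≥1}}) hy≤2) h≥2

small-exception : ∀ {h E y} → 2 ≤ h → 1 ≤ y → y < E → h * E * y ≤ h * (y * y) + 2 → h ≡ 2 × E ≡ 2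
small-exception {h} {E} {y} h≥2 y≥1 y<E bound with product≤2 h≥2 y≥1 hy≤2
  where
  open ≤-Reasoning
  hy≤2 : h * y ≤ 2
  hy≤2 = +-cancelˡ-≤ (h * (y * y)) _ _ (begin
    h * (y * y) + h * y  ≡⟨ solve (h ∷ y ∷ []) ⟩
    h * suc y * y        ≤⟨ *-monoˡ-≤ y (*-monoʳ-≤ h y<E) ⟩
    h * E * y            ≤⟨ bound ⟩
    h * (y * y) + 2      ∎)
... | refl , refl = refl , ≤-antisym (*-cancelˡ-≤ 2 (subst (_≤ 4) (*-identityʳ (2 * E)) bound)) y<E

hE²≡5 : ∀ {h E} → 2 ≤ h → 1 ≤ E → h * E * E ≡ 5 → h ≡ 5 × E ≡ 1
hE²≡5 {h} {E} h≥2 E≥1 eq = h≡5 , E≡1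
  where
  open ≡-Reasoning
  E≡1 : E ≡ 1
  E≡1 = ≤-antisym (≮⇒≥ λ 1<E → <⇒≱ (from-yes (5 <? 8))
          (subst (8 ≤_) eq (*-mono-≤ (*-mono-≤ h≥2 1<E) 1<E))) E≥1
  h≡5 : h ≡ 5
  h≡5 = begin
    h          ≡⟨ solve (h ∷ []) ⟩
    h * 1 * 1  ≡⟨ cong (λ t → h * t * t) (sym E≡1) ⟩
    h * E * E  ≡⟨ eq ⟩
    5          ∎

minimal-5 : MinimalUnit 5 1 1
minimal-5 = record
  { δ≥2 = from-yes (2 ≤? 5) ; c≥1 = ≤-refl ; f≥1 = ≤-refl ; norm = norm-4 refl
  ; norm-4⇒δ≥5 = λ _ → ≤-refl
  ; minimal = λ x≥1 y≥1 _ → y≥1 , λ _ → x≥1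
  }

minimal-8 : MinimalUnit 8 2 1
minimal-8 = record
  { δ≥2 = from-yes (2 ≤? 8) ; c≥1 = s≤s z≤n ; f≥1 = ≤-refl ; norm = norm-4 refl
  ; norm-4⇒δ≥5 = λ _ → from-yes (5 ≤? 8)
  ; minimal = λ x≥1 y≥1 s → y≥1 , λ { refl → square-cancel-≤ 2 _ (4≤x² s) }
  }
  where
  4≤x² : ∀ {x} → PellFour 8 x 1 → 4 ≤ x * x
  4≤x² (norm+4 hx) = ≤-trans (from-yes (4 ≤? 12)) (≤-reflexive (sym hx))
  4≤x² {x} (norm-4 hx) = ≤-reflexive (sym (+-cancelʳ-≡ 4 (x * x) 4 hx))

minimal-E²+4 : ∀ {E} → 1 ≤ E → MinimalUnit (E * E + 4) E 1
minimal-E²+4 {E} E≥1 = record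
  { δ≥2 = ≤-trans (from-yes (2 ≤? 4)) (m≤n+m 4 (E * E))
  ; c≥1 = E≥1
  ; f≥1 = ≤-refl
  ; norm = norm-4 (solve (E ∷ []))
  ; norm-4⇒δ≥5 = λ _ → +-monoˡ-≤ 4 (*-mono-≤ E≥1 E≥1)
  ; minimal = λ x≥1 y≥1 s → y≥1 , λ { refl → square-cancel-≤ E _ (E²≤x² s) }
  }
  where
  E²≤x² : ∀ {x} → PellFour (E * E + 4) x 1 → E * E ≤ x * x
  E²≤x² (norm+4 hx) = ≤-trans (m≤m+n (E * E) 8) (≤-reflexive (sym (trans hx (solve (E ∷ [])))))
  E²≤x² {x} (norm-4 hx) = ≤-reflexive (sym (+-cancelʳ-≡ 4 (x * x) (E * E) (trans hx (solve (E ∷ [])))))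

-- E = 3 is excluded: then δ = 5 and (E + √δ)/2 = ((1 + √5)/2)² is not minimal.
minimal-E²−4 : ∀ {E g} → 1 ≤ g → E * E ≡ g + 4 → E ≢ 3 → MinimalUnit g E 1
minimal-E²−4 {E} {g} g≥1 E²≡g+4 E≢3 = record
  { δ≥2 = ≤∧≢⇒< g≥1 λ 1≡g → square≢5 E (trans E²≡g+4 (cong (_+ 4) (sym 1≡g)))
  ; c≥1 = square-cancel-≤ 1 E (subst (1 ≤_) (sym E²≡g+4) (≤-trans (s≤s z≤n) (m≤n+m 4 g)))
  ; f≥1 = ≤-refl
  ; norm = norm+4 unit-norm
  ; norm-4⇒δ≥5 = λ eq → ⊥-elim (norm+4≢norm-4 E unit-norm eq)
  ; minimal = λ x≥1 y≥1 s → y≥1 , λ { refl → E≤x x≥1 s }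
  }
  where
  unit-norm : E * E ≡ g * (1 * 1) + 4
  unit-norm = trans E²≡g+4 (cong (_+ 4) (sym (*-identityʳ g)))
  E≤x : ∀ {x} → 1 ≤ x → PellFour g x 1 → E ≤ x
  E≤x {x} _ (norm+4 hx) = ≤-reflexive (square-injective E x (trans unit-norm (sym hx)))
  E≤x {x} x≥1 (norm-4 hx) = ⊥-elim (E≢3 (square+8≡square⇒3 (begin
    x * x + 8      ≡⟨ solve (x ∷ []) ⟩
    x * x + 4 + 4  ≡⟨ cong (_+ 4) (trans hx (*-identityʳ g)) ⟩
    g + 4          ≡⟨ sym E²≡g+4 ⟩
    E * E          ∎) x≥1))
    where open ≡-Reasoning

-- With z = h E y one has δ y² = z² + 4 h y², and the square gaps bound z by h y², i.e. E by y.
minimal-h[hE²+4] : ∀ {h E} → 2 ≤ h → 1 ≤ E → MinimalUnit (h * (h * E * E + 4)) (h * E * E + 2) E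
minimal-h[hE²+4] {h} {E} h≥2 E≥1 = record
  { δ≥2 = *-mono-≤ h≥2 (≤-trans (s≤s z≤n) (m≤n+m 4 _))
  ; c≥1 = ≤-trans (s≤s z≤n) (m≤n+m 2 _)
  ; f≥1 = E≥1
  ; norm = norm+4 (unit-norm h E)
  ; norm-4⇒δ≥5 = λ eq → ⊥-elim (norm+4≢norm-4 (h * E * E + 2) (unit-norm h E) eq)
  ; minimal = minimal
  }
  where
  open ≤-Reasoning
  h≥1 : 1 ≤ h
  h≥1 = ≤-trans (s≤s z≤n) h≥2
  δ = h * (h * E * E + 4)
  unit-norm : ∀ h E → (h * E * E + 2) * (h * E * E + 2) ≡ h * (h * E * E + 4) * (E * E) + 4
  unit-norm = solve-∀
  δ-split : ∀ h E y → h * (h * E * E + 4) * (y * y) ≡ (h * E * y) * (h * E * y) + 4 * (h * (y * y))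
  δ-split = solve-∀
  minimal : ∀ {x y} → 1 ≤ x → 1 ≤ y → PellFour δ x y → E ≤ y × (y ≡ E → h * E * E + 2 ≤ x)
  minimal {x} {y} _ y≥1 (norm+4 hx) = E≤y , λ { refl → ≤-reflexive (square-injective _ x (trans (unit-norm h E) (sym hx))) }
    where
    E≤y : E ≤ y
    E≤y = scaled-≤ h E y h≥1 y≥1 (s≤s⁻¹ (square-gap-lower x (h * E * y) (begin-equality
      x * x                                              ≡⟨ hx ⟩
      δ * (y * y) + 4                                    ≡⟨ cong (_+ 4) (δ-split h E y) ⟩
      (h * E * y) * (h * E * y) + 4 * (h * (y * y)) + 4  ≡⟨ solve (h ∷ E ∷ y ∷ []) ⟩
      (h * E * y) * (h * E * y) + 4 * (1 + h * (y * y))  ∎) (s≤s z≤n)))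
  minimal {x} {y} _ y≥1 (norm-4 hx) with m≤n⇒∃[o]m+o≡n (*-mono-≤ h≥2 (*-mono-≤ y≥1 y≥1))
  ... | o , 2+o≡hy² = <⇒≤ E<y , λ y≡E → ⊥-elim (<-irrefl (sym y≡E) E<y)
    where
    E<y : E < y
    E<y = scaled-< h E y (begin-strict
      h * E * y    <⟨ square-gap-lower x (h * E * y) (+-cancelʳ-≡ 4 _ _ (begin-equality
                        x * x + 4                                      ≡⟨ hx ⟩
                        δ * (y * y)                                    ≡⟨ δ-split h E y ⟩
                        (h * E * y) * (h * E * y) + 4 * (h * (y * y))  ≡⟨ cong (λ t → (h * E * y) * (h * E * y) + 4 * t) (sym 2+o≡hy²) ⟩
                        (h * E * y) * (h * E * y) + 4 * (2 + o)        ≡⟨ solve (h ∷ E ∷ y ∷ o ∷ []) ⟩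
                        (h * E * y) * (h * E * y) + 4 * (1 + o) + 4    ∎)) (s≤s z≤n) ⟩
      1 + o        <⟨ ≤-refl ⟩
      2 + o        ≡⟨ 2+o≡hy² ⟩
      h * (y * y)  ∎)

-- Now δ y² = z² − 4 h y² for z = h E y. The excluded (h, E) = (2, 2) and (5, 1) are those for
-- which (g + 2 + E √δ)/2 is (1 + √2)² resp. ((1 + √5)/2)², with δ = 8 resp. 5.
minimal-h[hE²−4] : ∀ {h E g} → 2 ≤ h → 1 ≤ E → 1 ≤ g → h * E * E ≡ g + 4 →
                   ¬ (h ≡ 2 × E ≡ 2) → ¬ (h ≡ 5 × E ≡ 1) → MinimalUnit (h * g) (g + 2) E
minimal-h[hE²−4] {h} {E} {g} h≥2 E≥1 g≥1 hE²≡g+4 not-2-2 not-5-1 = record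
  { δ≥2 = *-mono-≤ h≥2 g≥1
  ; c≥1 = ≤-trans (s≤s z≤n) (m≤n+m 2 g)
  ; f≥1 = E≥1
  ; norm = norm+4 unit-norm
  ; norm-4⇒δ≥5 = λ eq → ⊥-elim (norm+4≢norm-4 (g + 2) unit-norm eq)
  ; minimal = minimal
  }
  where
  open ≤-Reasoning
  h≥1 : 1 ≤ h
  h≥1 = ≤-trans (s≤s z≤n) h≥2
  unit-norm : (g + 2) * (g + 2) ≡ h * g * (E * E) + 4
  unit-norm = begin-equality
    (g + 2) * (g + 2)    ≡⟨ solve (g ∷ []) ⟩
    g * (g + 4) + 4      ≡⟨ cong (λ t → g * t + 4) (sym hE²≡g+4) ⟩
    g * (h * E * E) + 4  ≡⟨ solve (g ∷ h ∷ E ∷ []) ⟩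
    h * g * (E * E) + 4  ∎
  δ-split : ∀ y → h * g * (y * y) + 4 * (h * (y * y)) ≡ (h * E * y) * (h * E * y)
  δ-split y = begin-equality
    h * g * (y * y) + 4 * (h * (y * y))  ≡⟨ solve (h ∷ g ∷ y ∷ []) ⟩
    h * (g + 4) * (y * y)                ≡⟨ cong (λ t → h * t * (y * y)) (sym hE²≡g+4) ⟩
    h * (h * E * E) * (y * y)            ≡⟨ solve (h ∷ E ∷ y ∷ []) ⟩
    (h * E * y) * (h * E * y)            ∎
  minimal : ∀ {x y} → 1 ≤ x → 1 ≤ y → PellFour (h * g) x y → E ≤ y × (y ≡ E → g + 2 ≤ x)
  minimal {x} {y} x≥1 y≥1 (norm+4 hx) with m≤n⇒∃[o]m+o≡n (*-mono-≤ h≥2 (*-mono-≤ y≥1 y≥1))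
  ... | o , 2+o≡hy² = E≤y , λ { refl → ≤-reflexive (square-injective (g + 2) x (trans unit-norm (sym hx))) }
    where
    E≤y : E ≤ y
    E≤y = scaled-≤ h E y h≥1 y≥1 (begin
      h * E * y    ≤⟨ square-gap-upper x (h * E * y) {1 + o} (begin-equality
                        x * x + 4 * (1 + o)                  ≡⟨ cong (_+ 4 * (1 + o)) hx ⟩
                        h * g * (y * y) + 4 + 4 * (1 + o)    ≡⟨ solve (h ∷ g ∷ y ∷ o ∷ []) ⟩
                        h * g * (y * y) + 4 * (2 + o)        ≡⟨ cong (λ t → h * g * (y * y) + 4 * t) 2+o≡hy² ⟩
                        h * g * (y * y) + 4 * (h * (y * y))  ≡⟨ δ-split y ⟩
                        (h * E * y) * (h * E * y)            ∎) x≥1 (s≤s z≤n) ⟩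
      1 + o + 1    ≡⟨ solve (o ∷ []) ⟩
      2 + o        ≡⟨ 2+o≡hy² ⟩
      h * (y * y)  ∎)
  minimal {x} {y} x≥1 y≥1 (norm-4 hx) = E≤y , λ { refl → ⊥-elim (not-5-1 (hE²≡5 h≥2 y≥1 (trans hE²≡g+4 (cong (_+ 4) (g≡1 refl))))) }
    where
    bound : h * E * y ≤ h * (y * y) + 2
    bound = begin
      h * E * y            ≤⟨ square-gap-upper x (h * E * y) {h * (y * y) + 1} (begin-equality
                                x * x + 4 * (h * (y * y) + 1)        ≡⟨ solve (x ∷ h ∷ y ∷ []) ⟩
                                x * x + 4 + 4 * (h * (y * y))        ≡⟨ cong (_+ 4 * (h * (y * y))) hx ⟩
                                h * g * (y * y) + 4 * (h * (y * y))  ≡⟨ δ-split y ⟩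
                                (h * E * y) * (h * E * y)            ∎) x≥1 (m≤n+m 1 _) ⟩
      h * (y * y) + 1 + 1  ≡⟨ solve (h ∷ y ∷ []) ⟩
      h * (y * y) + 2      ∎
    E≤y : E ≤ y
    E≤y = ≮⇒≥ λ y<E → not-2-2 (small-exception h≥2 y≥1 y<E bound)
    g≡1 : y ≡ E → g ≡ 1
    g≡1 refl = +-cancelʳ-≡ 2 g 1 (square+8≡square⇒3 (begin-equality
      x * x + 8            ≡⟨ solve (x ∷ []) ⟩
      x * x + 4 + 4        ≡⟨ cong (_+ 4) hx ⟩
      h * g * (E * E) + 4  ≡⟨ sym unit-norm ⟩
      (g + 2) * (g + 2)    ∎) x≥1)

-- If the matrix [[P, Q], [R, P]] maps (X, Y) to (X', Y') and multiplies ratios by the same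
-- factor as the unit (c + f √δ)/2 (the three hypotheses, with √k = A √δ / 2), then it carries
-- X / Y = A x' / (2 y') to X' / Y' = A x / (2 y).
ratio-step : ∀ {A c f δ P Q R x' y' x y X Y X' Y'} → 1 ≤ A →
  A * c * R ≡ 2 * f * P → A * δ * f * P ≡ 2 * c * Q → A * A * δ * R ≡ 4 * Q →
  X' ≡ P * X + Q * Y → Y' ≡ R * X + P * Y → UnitStep δ c f x' y' x y →
  A * x' * Y ≡ 2 * y' * X → A * x * Y' ≡ 2 * y * X'
ratio-step {A} {c} {f} {δ} {P} {Q} {R} {x'} {y'} {x} {y} {X} {Y} {X'} {Y'}
           A≥1 compat₁ compat₂ compat₃ eX eY (unitStep hx hy) H =
  *-cancelˡ-≡ _ _ (2 * A) {{>-nonZero (*-monoʳ-< 2 A≥1)}} (begin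
    2 * A * (A * x * Y')
      ≡⟨ solve (A ∷ x ∷ Y' ∷ []) ⟩
    A * A * (2 * x) * Y'
      ≡⟨ cong₂ (λ u v → A * A * u * v) hx eY ⟩
    A * A * (c * x' + δ * f * y') * (R * X + P * Y)
      ≡⟨ solve (A ∷ c ∷ f ∷ δ ∷ P ∷ R ∷ x' ∷ y' ∷ X ∷ Y ∷ []) ⟩
    A * (A * c * R) * (x' * X) + A * c * P * (A * x' * Y) + (A * A * δ * R) * (f * (y' * X)) + A * (A * δ * f * P) * (y' * Y)
      ≡⟨ cong₂ (λ u v → A * u * (x' * X) + A * c * P * v + (A * A * δ * R) * (f * (y' * X)) + A * (A * δ * f * P) * (y' * Y)) compat₁ H ⟩
    A * (2 * f * P) * (x' * X) + A * c * P * (2 * y' * X) + (A * A * δ * R) * (f * (y' * X)) + A * (A * δ * f * P) * (y' * Y)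
      ≡⟨ cong₂ (λ u v → A * (2 * f * P) * (x' * X) + A * c * P * (2 * y' * X) + u * (f * (y' * X)) + A * v * (y' * Y)) compat₃ compat₂ ⟩
    A * (2 * f * P) * (x' * X) + A * c * P * (2 * y' * X) + (4 * Q) * (f * (y' * X)) + A * (2 * c * Q) * (y' * Y)
      ≡⟨ solve (A ∷ c ∷ f ∷ P ∷ Q ∷ x' ∷ y' ∷ X ∷ Y ∷ []) ⟩
    A * (2 * f * P) * (x' * X) + A * c * P * (2 * y' * X) + (2 * f * Q) * (2 * y' * X) + A * (2 * c * Q) * (y' * Y)
      ≡⟨ cong (λ u → A * (2 * f * P) * (x' * X) + A * c * P * (2 * y' * X) + (2 * f * Q) * u + A * (2 * c * Q) * (y' * Y)) (sym H) ⟩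
    A * (2 * f * P) * (x' * X) + A * c * P * (2 * y' * X) + (2 * f * Q) * (A * x' * Y) + A * (2 * c * Q) * (y' * Y)
      ≡⟨ solve (A ∷ c ∷ f ∷ P ∷ Q ∷ x' ∷ y' ∷ X ∷ Y ∷ []) ⟩
    2 * A * ((f * x' + c * y') * (P * X + Q * Y))
      ≡⟨ cong₂ (λ u v → 2 * A * (u * v)) (sym hy) (sym eX) ⟩
    2 * A * (2 * y * X') ∎)
  where open ≡-Reasoning

module _ (k d : ℕ) where
  private
    X Y : ℕ → ℕ
    X n = proj₁ (orbit k d n)
    Y n = proj₂ (orbit k d n)

  -- Some f^n(∞) equals A x / (2 y), the approximation of √k = A √δ / 2 given by a solution (x, y)
  -- of x² − δ y² = ±4.
  Hits : ℕ → ℕ → ℕ → Set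
  Hits A x y = ∃[ n ] (1 ≤ n × A * x * Y n ≡ 2 * y * X n)

  record OrbitShift (s P Q R : ℕ) : Set where
    field
      s≥1     : 1 ≤ s
      X-shift : ∀ n → X (s + n) ≡ P * X n + Q * Y n
      Y-shift : ∀ n → Y (s + n) ≡ R * X n + P * Y n

  orbitShift-1 : OrbitShift 1 d k 1
  orbitShift-1 = record
    { s≥1 = s≤s z≤n
    ; X-shift = λ n → refl
    ; Y-shift = λ n → cong (_+ d * Y n) (sym (*-identityˡ (X n)))
    }

  orbitShift-2 : OrbitShift 2 (d * d + k) (2 * d * k) (2 * d)
  orbitShift-2 = record
    { s≥1 = s≤s z≤n
    ; X-shift = λ n → square-x d k (X n) (Y n)
    ; Y-shift = λ n → square-y d k (X n) (Y n)
    }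
    where
    square-x : ∀ d k x y → d * (d * x + k * y) + k * (x + d * y) ≡ (d * d + k) * x + (2 * d * k) * y
    square-x = solve-∀
    square-y : ∀ d k x y → (d * x + k * y) + d * (x + d * y) ≡ (2 * d) * x + (d * d + k) * y
    square-y = solve-∀

  -- f^s corresponds to P + R √k = P + (A R / 2) √δ, a multiple of the unit (c + f √δ)/2.
  record UnitOrbit (A δ c f : ℕ) : Set where
    field
      {s P Q R} : ℕ
      orbitShift : OrbitShift s P Q R
      compat₁    : A * c * R ≡ 2 * f * P
      compat₂    : A * δ * f * P ≡ 2 * c * Q
      compat₃    : A * A * δ * R ≡ 4 * Q

  module _ {A δ c f : ℕ} (A≥1 : 1 ≤ A) (orb : UnitOrbit A δ c f) where
    open UnitOrbit orb
    open OrbitShift orbitShift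

    hits-unit : Hits A c f
    hits-unit = s , s≥1 , (begin
      A * c * Y s        ≡⟨ cong (λ t → A * c * Y t) (sym (+-identityʳ s)) ⟩
      A * c * Y (s + 0)  ≡⟨ cong (A * c *_) (trans (Y-shift 0) (first-column R P)) ⟩
      A * c * R          ≡⟨ compat₁ ⟩
      2 * f * P          ≡⟨ cong (2 * f *_) (sym (trans (X-shift 0) (first-column P Q))) ⟩
      2 * f * X (s + 0)  ≡⟨ cong (λ t → 2 * f * X t) (+-identityʳ s) ⟩
      2 * f * X s        ∎)
      where
      open ≡-Reasoning
      first-column : ∀ u v → u * 1 + v * 0 ≡ u
      first-column = solve-∀

    hits-step : ∀ {x' y' x y} → Hits A x' y' → UnitStep δ c f x' y' x y → Hits A x y
    hits-step (n , n≥1 , H) st = s + n , ≤-trans n≥1 (m≤n+m n s) ,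
      ratio-step A≥1 compat₁ compat₂ compat₃ (X-shift n) (Y-shift n) st H

    solutions-hit : MinimalUnit δ c f → ∀ {x y} → 1 ≤ x → 1 ≤ y → PellFour δ x y → Hits A x y
    solutions-hit ε = unit-induction ε (Hits A) hits-unit hits-step

module _ {k d A δ : ℕ} where
  open ≡-Reasoning

  unitOrbit-1 : ∀ {E} → 2 * d ≡ A * E → 4 * k ≡ A * A * δ → UnitOrbit k d A δ E 1
  unitOrbit-1 {E} 2d≡AE 4k≡A²δ = record
    { orbitShift = orbitShift-1 k d
    ; compat₁ = begin
        A * E * 1  ≡⟨ solve (A ∷ E ∷ []) ⟩
        A * E      ≡⟨ sym 2d≡AE ⟩
        2 * d      ≡⟨ solve (d ∷ []) ⟩
        2 * 1 * d  ∎
    ; compat₂ = *-cancelˡ-≡ _ _ 2 (begin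
        2 * (A * δ * 1 * d)  ≡⟨ solve (A ∷ δ ∷ d ∷ []) ⟩
        A * δ * (2 * d)      ≡⟨ cong (A * δ *_) 2d≡AE ⟩
        A * δ * (A * E)      ≡⟨ solve (A ∷ δ ∷ E ∷ []) ⟩
        E * (A * A * δ)      ≡⟨ cong (E *_) (sym 4k≡A²δ) ⟩
        E * (4 * k)          ≡⟨ solve (E ∷ k ∷ []) ⟩
        2 * (2 * E * k)      ∎)
    ; compat₃ = begin
        A * A * δ * 1  ≡⟨ solve (A ∷ δ ∷ []) ⟩
        A * A * δ      ≡⟨ sym 4k≡A²δ ⟩
        4 * k          ∎
    }

  unitOrbit-2 : ∀ {h E c} → 2 * d ≡ A * h * E → 4 * k ≡ A * A * δ → 2 * (d * d + k) ≡ A * A * h * c →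
                UnitOrbit k d A δ c E
  unitOrbit-2 {h} {E} {c} 2d≡AhE 4k≡A²δ 2[d²+k]≡A²hc = record
    { orbitShift = orbitShift-2 k d
    ; compat₁ = begin
        A * c * (2 * d)      ≡⟨ cong (A * c *_) 2d≡AhE ⟩
        A * c * (A * h * E)  ≡⟨ solve (A ∷ c ∷ h ∷ E ∷ []) ⟩
        E * (A * A * h * c)  ≡⟨ cong (E *_) (sym 2[d²+k]≡A²hc) ⟩
        E * (2 * (d * d + k)) ≡⟨ solve (E ∷ d ∷ k ∷ []) ⟩
        2 * E * (d * d + k)  ∎
    ; compat₂ = *-cancelˡ-≡ _ _ 2 (begin
        2 * (A * δ * E * (d * d + k))         ≡⟨ solve (A ∷ δ ∷ E ∷ d ∷ k ∷ []) ⟩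
        A * δ * E * (2 * (d * d + k))         ≡⟨ cong (A * δ * E *_) 2[d²+k]≡A²hc ⟩
        A * δ * E * (A * A * h * c)           ≡⟨ solve (A ∷ δ ∷ E ∷ h ∷ c ∷ []) ⟩
        c * (A * h * E) * (A * A * δ)         ≡⟨ cong₂ (λ u v → c * u * v) (sym 2d≡AhE) (sym 4k≡A²δ) ⟩
        c * (2 * d) * (4 * k)                 ≡⟨ solve (c ∷ d ∷ k ∷ []) ⟩
        2 * (2 * c * (2 * d * k))             ∎)
    ; compat₃ = begin
        A * A * δ * (2 * d)  ≡⟨ cong (_* (2 * d)) (sym 4k≡A²δ) ⟩
        4 * k * (2 * d)      ≡⟨ solve (k ∷ d ∷ []) ⟩
        4 * (2 * d * k)      ∎
    }

Pellian : ℕ → ℕ → ℕ → Set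
Pellian k p q = p * p ≡ k * (q * q) + 1 ⊎ p * p + 1 ≡ k * (q * q)

pellian⇒pellFour : ∀ {k A δ p q} → 4 * k ≡ A * A * δ → Pellian k p q → PellFour δ (2 * p) (q * A)
pellian⇒pellFour {k} {A} {δ} {p} {q} 4k≡A²δ (inj₁ hp) = norm+4 (begin
  2 * p * (2 * p)            ≡⟨ solve (p ∷ []) ⟩
  4 * (p * p)                ≡⟨ cong (4 *_) hp ⟩
  4 * (k * (q * q) + 1)      ≡⟨ solve (k ∷ q ∷ []) ⟩
  4 * k * (q * q) + 4        ≡⟨ cong (λ t → t * (q * q) + 4) 4k≡A²δ ⟩
  A * A * δ * (q * q) + 4    ≡⟨ solve (A ∷ δ ∷ q ∷ []) ⟩
  δ * (q * A * (q * A)) + 4  ∎)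
  where open ≡-Reasoning
pellian⇒pellFour {k} {A} {δ} {p} {q} 4k≡A²δ (inj₂ hp) = norm-4 (begin
  2 * p * (2 * p) + 4        ≡⟨ solve (p ∷ []) ⟩
  4 * (p * p + 1)            ≡⟨ cong (4 *_) hp ⟩
  4 * (k * (q * q))          ≡⟨ solve (k ∷ q ∷ []) ⟩
  4 * k * (q * q)            ≡⟨ cong (_* (q * q)) 4k≡A²δ ⟩
  A * A * δ * (q * q)        ≡⟨ solve (A ∷ δ ∷ q ∷ []) ⟩
  δ * (q * A * (q * A))      ∎)
  where open ≡-Reasoning

PelliansHit : ℕ → ℕ → Set
PelliansHit k d = ∀ {p q} → 1 ≤ p → 1 ≤ q → Pellian k p q → ∃[ n ] (1 ≤ n × OrbitHits k d n p q)

hits⇒orbitHits : ∀ {k d A p q} → 1 ≤ A → Hits k d A (2 * p) (q * A) → ∃[ n ] (1 ≤ n × OrbitHits k d n p q)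
hits⇒orbitHits {k} {d} {A} {p} {q} A≥1 (n , n≥1 , H) = n , n≥1 ,
  *-cancelˡ-≡ _ _ (2 * A) {{>-nonZero (*-monoʳ-< 2 A≥1)}} (begin
    2 * A * (p * Y)  ≡⟨ reorder₁ A p Y ⟩
    A * (2 * p) * Y  ≡⟨ H ⟩
    2 * (q * A) * X  ≡⟨ reorder₂ q A X ⟩
    2 * A * (q * X)  ∎)
  where
  open ≡-Reasoning
  X = proj₁ (orbit k d n)
  Y = proj₂ (orbit k d n)
  reorder₁ : ∀ A p Y → 2 * A * (p * Y) ≡ A * (2 * p) * Y
  reorder₁ = solve-∀
  reorder₂ : ∀ q A X → 2 * (q * A) * X ≡ 2 * A * (q * X)
  reorder₂ = solve-∀

pellians-hit : ∀ {k d A δ c f} → 1 ≤ A → MinimalUnit δ c f → UnitOrbit k d A δ c f → 4 * k ≡ A * A * δ →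
               PelliansHit k d
pellians-hit {k} {d} {A} {δ} A≥1 ε orb 4k≡A²δ {p} {q} p≥1 q≥1 pell = hits⇒orbitHits {p = p} {q} A≥1
  (solutions-hit k d A≥1 orb ε (*-mono-≤ (s≤s (z≤n {1})) p≥1) (*-mono-≤ q≥1 A≥1)
    (pellian⇒pellFour {k} {A} {δ} {p} {q} 4k≡A²δ pell))

module _ {δ c f : ℕ} where
  open ≡-Reasoning

  unitStep-deterministic : ∀ {a b x y x' y'} → UnitStep δ c f a b x y → UnitStep δ c f a b x' y' →
                           x ≡ x' × y ≡ y'
  unitStep-deterministic (unitStep hx hy) (unitStep hx' hy') =
    *-cancelˡ-≡ _ _ 2 (trans hx (sym hx')) , *-cancelˡ-≡ _ _ 2 (trans hy (sym hy'))

  unitStep-+ : ∀ {a b a' b' α β α' β'} → UnitStep δ c f a b a' b' → UnitStep δ c f α β α' β' →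
               UnitStep δ c f (a + α) (b + β) (a' + α') (b' + β')
  unitStep-+ {a} {b} {a'} {b'} {α} {β} {α'} {β'} (unitStep hx hy) (unitStep hξ hη) = unitStep
    (begin
      2 * (a' + α')                      ≡⟨ *-distribˡ-+ 2 a' α' ⟩
      2 * a' + 2 * α'                    ≡⟨ cong₂ _+_ hx hξ ⟩
      c * a + δ * f * b + (c * α + δ * f * β) ≡⟨ solve (δ ∷ c ∷ f ∷ a ∷ b ∷ α ∷ β ∷ []) ⟩
      c * (a + α) + δ * f * (b + β)      ∎)
    (begin
      2 * (b' + β')                      ≡⟨ *-distribˡ-+ 2 b' β' ⟩
      2 * b' + 2 * β'                    ≡⟨ cong₂ _+_ hy hη ⟩
      f * a + c * b + (f * α + c * β)    ≡⟨ solve (c ∷ f ∷ a ∷ b ∷ α ∷ β ∷ []) ⟩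
      f * (a + α) + c * (b + β)          ∎)

  unitStep-scale : ∀ m {a b a' b'} → UnitStep δ c f a b a' b' → UnitStep δ c f (m * a) (m * b) (m * a') (m * b')
  unitStep-scale m {a} {b} {a'} {b'} (unitStep hx hy) = unitStep
    (begin
      2 * (m * a')            ≡⟨ solve (m ∷ a' ∷ []) ⟩
      m * (2 * a')            ≡⟨ cong (m *_) hx ⟩
      m * (c * a + δ * f * b) ≡⟨ solve (m ∷ δ ∷ c ∷ f ∷ a ∷ b ∷ []) ⟩
      c * (m * a) + δ * f * (m * b) ∎)
    (begin
      2 * (m * b')            ≡⟨ solve (m ∷ b' ∷ []) ⟩
      m * (2 * b')            ≡⟨ cong (m *_) hy ⟩
      m * (f * a + c * b)     ≡⟨ solve (m ∷ c ∷ f ∷ a ∷ b ∷ []) ⟩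
      f * (m * a) + c * (m * b) ∎)

  unitStep-square : ∀ {C F a b a' b' a'' b''} → 2 * C ≡ c * c + δ * (f * f) → F ≡ c * f →
                    UnitStep δ c f a b a' b' → UnitStep δ c f a' b' a'' b'' → UnitStep δ C F a b a'' b''
  unitStep-square {C} {F} {a} {b} {a'} {b'} {a''} {b''} 2C≡ F≡ (unitStep hx hy) (unitStep hx' hy') = unitStep
    (*-cancelˡ-≡ _ _ 2 (begin
      2 * (2 * a'')                               ≡⟨ cong (2 *_) hx' ⟩
      2 * (c * a' + δ * f * b')                   ≡⟨ solve (δ ∷ c ∷ f ∷ a' ∷ b' ∷ []) ⟩
      c * (2 * a') + δ * f * (2 * b')             ≡⟨ cong₂ (λ u v → c * u + δ * f * v) hx hy ⟩
      c * (c * a + δ * f * b) + δ * f * (f * a + c * b) ≡⟨ solve (δ ∷ c ∷ f ∷ a ∷ b ∷ []) ⟩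
      (c * c + δ * (f * f)) * a + 2 * (δ * (c * f) * b) ≡⟨ cong₂ (λ u v → u * a + 2 * (δ * v * b)) (sym 2C≡) (sym F≡) ⟩
      2 * C * a + 2 * (δ * F * b)                 ≡⟨ solve (δ ∷ C ∷ F ∷ a ∷ b ∷ []) ⟩
      2 * (C * a + δ * F * b)                     ∎))
    (*-cancelˡ-≡ _ _ 2 (begin
      2 * (2 * b'')                               ≡⟨ cong (2 *_) hy' ⟩
      2 * (f * a' + c * b')                       ≡⟨ solve (c ∷ f ∷ a' ∷ b' ∷ []) ⟩
      f * (2 * a') + c * (2 * b')                 ≡⟨ cong₂ (λ u v → f * u + c * v) hx hy ⟩
      f * (c * a + δ * f * b) + c * (f * a + c * b) ≡⟨ solve (δ ∷ c ∷ f ∷ a ∷ b ∷ []) ⟩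
      2 * ((c * f) * a) + (c * c + δ * (f * f)) * b ≡⟨ cong₂ (λ u v → 2 * (u * a) + v * b) (sym F≡) (sym 2C≡) ⟩
      2 * (F * a) + 2 * C * b                     ≡⟨ solve (C ∷ F ∷ a ∷ b ∷ []) ⟩
      2 * (F * a + C * b)                         ∎))

-- When the unit (C + F √δ)/2 attached to f is the square of the minimal unit η = (c + f √δ)/2,
-- and (u i + v i √δ)/2 = ηⁱ, only the even powers of η are reached by the orbit.
module Powers {δ c f : ℕ} (η : MinimalUnit δ c f) (u v : ℕ → ℕ) (u₁ : u 1 ≡ c) (v₁ : v 1 ≡ f)
              (η-step : ∀ i → UnitStep δ c f (u i) (v i) (u (suc i)) (v (suc i))) where

  IsPower : ℕ → ℕ → Set
  IsPower x y = ∃[ i ] (1 ≤ i × x ≡ u i × y ≡ v i)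

  solutions-are-powers : ∀ {x y} → 1 ≤ x → 1 ≤ y → PellFour δ x y → IsPower x y
  solutions-are-powers = unit-induction η IsPower (1 , ≤-refl , sym u₁ , sym v₁) next
    where
    next : ∀ {x' y' x y} → IsPower x' y' → UnitStep δ c f x' y' x y → IsPower x y
    next (i , _ , refl , refl) st = suc i , s≤s z≤n , unitStep-deterministic st (η-step i)

  module _ {k d A C F : ℕ} (A≥1 : 1 ≤ A) (2C≡c²+δf² : 2 * C ≡ c * c + δ * (f * f)) (F≡cf : F ≡ c * f)
           (orb : UnitOrbit k d A δ C F) where

    even-powers-hit : ∀ w → Hits k d A (u (suc w * 2)) (v (suc w * 2))
    even-powers-hit zero = subst₂ (Hits k d A) (sym (proj₁ u₂≡C×v₂≡F)) (sym (proj₂ u₂≡C×v₂≡F)) (hits-unit k d A≥1 orb)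
      where
      η² : UnitStep δ c f c f C F
      η² = unitStep (trans 2C≡c²+δf² (cong (_+_ (c * c)) (sym (*-assoc δ f f))))
                    (trans (cong (2 *_) F≡cf) (solve (c ∷ f ∷ [])))
      u₂≡C×v₂≡F : u 2 ≡ C × v 2 ≡ F
      u₂≡C×v₂≡F = unitStep-deterministic (subst₂ (λ a b → UnitStep δ c f a b (u 2) (v 2)) u₁ v₁ (η-step 1)) η²
    even-powers-hit (suc w) = hits-step k d A≥1 orb (even-powers-hit w)
      (unitStep-square 2C≡c²+δf² F≡cf (η-step (suc w * 2)) (η-step (suc (suc w * 2))))

    even-pellians-hit : 4 * k ≡ A * A * δ → ∀ {p q} → 1 ≤ p → 1 ≤ q → (∀ w → q * A ≢ v (2 * w + 1)) →
                        Pellian k p q → ∃[ n ] (1 ≤ n × OrbitHits k d n p q)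
    even-pellians-hit 4k≡A²δ {p} {q} p≥1 q≥1 odd-excluded pell
      with solutions-are-powers (*-mono-≤ (s≤s (z≤n {1})) p≥1) (*-mono-≤ q≥1 A≥1)
             (pellian⇒pellFour {k} {A} {δ} {p} {q} 4k≡A²δ pell)
    ... | i , i≥1 , 2p≡uᵢ , qA≡vᵢ with even-or-odd i
    ...   | zero  , inj₁ refl = ⊥-elim (<⇒≱ i≥1 z≤n)
    ...   | suc w , inj₁ refl = hits⇒orbitHits {p = p} {q} A≥1 (subst₂ (Hits k d A)
            (sym (trans 2p≡uᵢ (cong u (*-comm 2 (suc w))))) (sym (trans qA≡vᵢ (cong v (*-comm 2 (suc w)))))
            (even-powers-hit w))
    ...   | w     , inj₂ refl = ⊥-elim (odd-excluded w (trans qA≡vᵢ (cong v (+-comm 1 (2 * w)))))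

lucas : ℕ → ℕ
lucas zero = 2
lucas (suc zero) = 1
lucas (suc (suc n)) = lucas (suc n) + lucas n

-- (lucas i + F i √5)/2 = ((1 + √5)/2)ⁱ
lucas-step : ∀ i → UnitStep 5 1 1 (lucas i) (F i) (lucas (suc i)) (F (suc i))
lucas-step zero = unitStep refl refl
lucas-step (suc zero) = unitStep refl refl
lucas-step (suc (suc i)) = unitStep-+ (lucas-step (suc i)) (lucas-step i)

pellLucas : ℕ → ℕ
pellLucas zero = 2
pellLucas (suc zero) = 2
pellLucas (suc (suc n)) = 2 * pellLucas (suc n) + pellLucas n

-- (pellLucas i + G i √8)/2 = (1 + √2)ⁱ
pellLucas-step : ∀ i → UnitStep 8 2 1 (pellLucas i) (G i) (pellLucas (suc i)) (G (suc i))
pellLucas-step zero = unitStep refl refl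
pellLucas-step (suc zero) = unitStep refl refl
pellLucas-step (suc (suc i)) = unitStep-+ (unitStep-scale 2 (pellLucas-step (suc i))) (pellLucas-step i)

module _ {k d A : ℕ} (A≥1 : 1 ≤ A) where

  fibonacci-pellians-hit : UnitOrbit k d A 5 3 1 → 4 * k ≡ A * A * 5 →
    ∀ {p q} → 1 ≤ p → 1 ≤ q → (∀ w → q * A ≢ F (2 * w + 1)) → Pellian k p q → ∃[ n ] (1 ≤ n × OrbitHits k d n p q)
  fibonacci-pellians-hit = Powers.even-pellians-hit minimal-5 lucas F refl refl lucas-step A≥1 refl refl

  pell-pellians-hit : UnitOrbit k d A 8 6 2 → 4 * k ≡ A * A * 8 →
    ∀ {p q} → 1 ≤ p → 1 ≤ q → (∀ w → q * A ≢ G (2 * w + 1)) → Pellian k p q → ∃[ n ] (1 ≤ n × OrbitHits k d n p q)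
  pell-pellians-hit = Powers.even-pellians-hit minimal-8 pellLucas G refl refl pellLucas-step A≥1 refl refl

FibonacciException : ℕ → ℕ → Set
FibonacciException k d =
  ∃[ s ] (0 < s × k ≡ 5 * (s * s) × (d ≡ 3 * s ⊎ d ≡ 5 * s) × (∃[ n ] ((2 * s) ∣ F (2 * n + 1))))

PellException : ℕ → ℕ → Set
PellException k d = ∃[ s ] (0 < s × k ≡ 2 * (s * s) × d ≡ 2 * s × (∃[ n ] (s ∣ G (2 * n + 1))))

odd-multiple⇒even : ∀ {A d} m → 2 * d ≡ A * (1 + 2 * m) → ∃[ s ] A ≡ 2 * s
odd-multiple⇒even {A} {d} m eq with even-or-odd A
... | s , inj₁ A≡2s = s , A≡2s
... | s , inj₂ refl = ⊥-elim (even≢odd d (s + m + 2 * (s * m)) (trans eq (odd-product s m)))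
  where
  odd-product : ∀ s m → (1 + 2 * s) * (1 + 2 * m) ≡ 1 + 2 * (s + m + 2 * (s * m))
  odd-product = solve-∀

fibonacci-case : ∀ {k d A} → 1 ≤ A → 4 * k ≡ A * A * 5 → 2 * d ≡ A * 3 ⊎ 2 * d ≡ A * 5 →
                 UnitOrbit k d A 5 3 1 → ¬ FibonacciException k d → PelliansHit k d
fibonacci-case {k} {d} {A} A≥1 4k≡5A² 2d≡ orb no-exception {q = q} p≥1 q≥1 =
  fibonacci-pellians-hit A≥1 orb 4k≡5A² p≥1 q≥1 odd-excluded
  where
  A-even : ∃[ s ] A ≡ 2 * s
  A-even = [ odd-multiple⇒even {d = d} 1 , odd-multiple⇒even {d = d} 2 ]′ 2d≡
  odd-excluded : ∀ w → q * A ≢ F (2 * w + 1)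
  odd-excluded w qA≡F with A-even
  ... | s , refl = no-exception (s , half-positive A≥1 refl , k≡5s² , d≡ 2d≡ , w , divides q (sym qA≡F))
    where
    k≡5s² : k ≡ 5 * (s * s)
    k≡5s² = *-cancelˡ-≡ _ _ 4 (trans 4k≡5A² (solve (s ∷ [])))
    d≡ : 2 * d ≡ 2 * s * 3 ⊎ 2 * d ≡ 2 * s * 5 → d ≡ 3 * s ⊎ d ≡ 5 * s
    d≡ (inj₁ eq) = inj₁ (*-cancelˡ-≡ _ _ 2 (trans eq (solve (s ∷ []))))
    d≡ (inj₂ eq) = inj₂ (*-cancelˡ-≡ _ _ 2 (trans eq (solve (s ∷ []))))

pell-case : ∀ {k d A} → 1 ≤ A → 4 * k ≡ A * A * 8 → 2 * d ≡ A * 4 →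
            UnitOrbit k d A 8 6 2 → ¬ PellException k d → PelliansHit k d
pell-case {k} {d} {A} A≥1 4k≡8A² 2d≡4A orb no-exception {q = q} p≥1 q≥1 =
  pell-pellians-hit A≥1 orb 4k≡8A² p≥1 q≥1 λ w qA≡G →
    no-exception (A , A≥1 , *-cancelˡ-≡ _ _ 4 (trans 4k≡8A² (solve (A ∷ []))) ,
                  *-cancelˡ-≡ _ _ 2 (trans 2d≡4A (solve (A ∷ []))) , w , divides q (sym qA≡G))

above-square-identities : ∀ {k d a A h E} → k ≡ d * d + a → a ≡ A * A * h → 2 * d ≡ A * h * E →
  4 * k ≡ A * A * (h * (h * E * E + 4)) × 2 * (d * d + k) ≡ A * A * h * (h * E * E + 2)
above-square-identities {k} {d} {a} {A} {h} {E} k≡d²+a a≡A²h 2d≡AhE = (begin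
    4 * k                                        ≡⟨ cong (4 *_) k≡d²+a ⟩
    4 * (d * d + a)                              ≡⟨ solve (d ∷ a ∷ []) ⟩
    (2 * d) * (2 * d) + 4 * a                    ≡⟨ cong₂ (λ u v → u * u + 4 * v) 2d≡AhE a≡A²h ⟩
    (A * h * E) * (A * h * E) + 4 * (A * A * h)  ≡⟨ solve (A ∷ h ∷ E ∷ []) ⟩
    A * A * (h * (h * E * E + 4))                ∎)
  , (begin
    2 * (d * d + k)                              ≡⟨ cong (λ t → 2 * (d * d + t)) k≡d²+a ⟩
    2 * (d * d + (d * d + a))                    ≡⟨ solve (d ∷ a ∷ []) ⟩
    (2 * d) * (2 * d) + 2 * a                    ≡⟨ cong₂ (λ u v → u * u + 2 * v) 2d≡AhE a≡A²h ⟩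
    (A * h * E) * (A * h * E) + 2 * (A * A * h)  ≡⟨ solve (A ∷ h ∷ E ∷ []) ⟩
    A * A * h * (h * E * E + 2)                  ∎)
  where open ≡-Reasoning

above-square : ∀ {k d a} → k ≡ d * d + a → SquareFactorisation a (2 * d) → PelliansHit k d
above-square {k} {d} {a} k≡d²+a (factorisation A h E A≥1 h≥1 E≥1 a≡A²h 2d≡AhE)
  with above-square-identities {k} {d} {a} {A} {h} {E} k≡d²+a a≡A²h 2d≡AhE | m≤n⇒m<n∨m≡n h≥1
... | 4k≡ , 2[d²+k]≡ | inj₁ h≥2 =
  pellians-hit A≥1 (minimal-h[hE²+4] h≥2 E≥1) (unitOrbit-2 2d≡AhE 4k≡ 2[d²+k]≡) 4k≡
... | 4k≡ , _ | inj₂ refl =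
  pellians-hit A≥1 (minimal-E²+4 E≥1) (unitOrbit-1 (trans 2d≡AhE (solve (A ∷ E ∷ []))) 4k≡A²[E²+4]) 4k≡A²[E²+4]
  where
  4k≡A²[E²+4] : 4 * k ≡ A * A * (E * E + 4)
  4k≡A²[E²+4] = trans 4k≡ (solve (A ∷ E ∷ []))

below-square-identity : ∀ {k d a A h E} → d * d ≡ k + a → a ≡ A * A * h → 2 * d ≡ A * h * E →
                        A * A * h * (h * E * E) ≡ 4 * k + A * A * h * 4
below-square-identity {k} {d} {a} {A} {h} {E} d²≡k+a a≡A²h 2d≡AhE = begin
  A * A * h * (h * E * E)   ≡⟨ solve (A ∷ h ∷ E ∷ []) ⟩
  (A * h * E) * (A * h * E) ≡⟨ cong (λ t → t * t) (sym 2d≡AhE) ⟩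
  (2 * d) * (2 * d)         ≡⟨ solve (d ∷ []) ⟩
  4 * (d * d)               ≡⟨ cong (4 *_) d²≡k+a ⟩
  4 * (k + a)               ≡⟨ cong (λ t → 4 * (k + t)) a≡A²h ⟩
  4 * (k + A * A * h)       ≡⟨ solve (k ∷ A ∷ h ∷ []) ⟩
  4 * k + A * A * h * 4     ∎
  where open ≡-Reasoning

below-square-shape : ∀ {k d a A h E} → 1 ≤ k → d * d ≡ k + a → a ≡ A * A * h → 2 * d ≡ A * h * E →
  ∃[ g ] (1 ≤ g × h * E * E ≡ g + 4 × 4 * k ≡ A * A * (h * g) × 2 * (d * d + k) ≡ A * A * h * (g + 2))
below-square-shape {k} {d} {a} {A} {h} {E} k≥1 d²≡k+a a≡A²h 2d≡AhE =
  shape (below-square-identity {k} {d} {a} {A} {h} {E} d²≡k+a a≡A²h 2d≡AhE)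
  where
  open ≡-Reasoning
  identities : ∀ g → A * A * h * (h * E * E) ≡ 4 * k + A * A * h * 4 → h * E * E ≡ g + 4 →
               4 * k ≡ A * A * (h * g) × 2 * (d * d + k) ≡ A * A * h * (g + 2)
  identities g scaled hE²≡g+4 = 4k≡ , (begin
      2 * (d * d + k)                   ≡⟨ cong (λ t → 2 * (t + k)) d²≡k+a ⟩
      2 * (k + a + k)                   ≡⟨ solve (k ∷ a ∷ []) ⟩
      4 * k + 2 * a                     ≡⟨ cong₂ (λ u v → u + 2 * v) 4k≡ a≡A²h ⟩
      A * A * (h * g) + 2 * (A * A * h) ≡⟨ solve (A ∷ h ∷ g ∷ []) ⟩
      A * A * h * (g + 2)               ∎)
    where
    4k≡ : 4 * k ≡ A * A * (h * g)
    4k≡ = +-cancelʳ-≡ (A * A * h * 4) _ _ (sym (begin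
      A * A * (h * g) + A * A * h * 4  ≡⟨ solve (A ∷ h ∷ g ∷ []) ⟩
      A * A * h * (g + 4)              ≡⟨ cong (A * A * h *_) (sym hE²≡g+4) ⟩
      A * A * h * (h * E * E)          ≡⟨ scaled ⟩
      4 * k + A * A * h * 4            ∎))
  -- 4 k = (A h E)² − 4 A² h is positive, so h E² > 4.
  4<hE² : A * A * h * (h * E * E) ≡ 4 * k + A * A * h * 4 → 4 < h * E * E
  4<hE² scaled = ≰⇒> λ hE²≤4 → <⇒≱ (*-monoʳ-< 4 k≥1)
    (+-cancelʳ-≤ (A * A * h * 4) (4 * k) 0 (≤-trans (≤-reflexive (sym scaled)) (*-monoʳ-≤ (A * A * h) hE²≤4)))
  shape : A * A * h * (h * E * E) ≡ 4 * k + A * A * h * 4 →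
    ∃[ g ] (1 ≤ g × h * E * E ≡ g + 4 × 4 * k ≡ A * A * (h * g) × 2 * (d * d + k) ≡ A * A * h * (g + 2))
  shape scaled with m≤n⇒∃[o]m+o≡n (4<hE² scaled)
  ... | o , 5+o≡hE² = suc o , s≤s z≤n , hE²≡g+4 , identities (suc o) scaled hE²≡g+4
    where
    hE²≡g+4 : h * E * E ≡ suc o + 4
    hE²≡g+4 = trans (sym 5+o≡hE²) (trans (+-comm 5 o) (+-suc o 4))

below-square : ∀ {k d a} → 1 ≤ k → d * d ≡ k + a → SquareFactorisation a (2 * d) →
               ¬ FibonacciException k d → ¬ PellException k d → PelliansHit k d
below-square {k} {d} {a} k≥1 d²≡k+a (factorisation A h E A≥1 h≥1 E≥1 a≡A²h 2d≡AhE) no-fibonacci no-pell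
  with below-square-shape {k} {d} {a} {A} {h} {E} k≥1 d²≡k+a a≡A²h 2d≡AhE | m≤n⇒m<n∨m≡n h≥1
... | g , g≥1 , hE²≡g+4 , 4k≡ , _ | inj₂ refl with E ≟ 3
...   | no E≢3 =
  let 4k≡A²g : 4 * k ≡ A * A * g
      4k≡A²g = trans 4k≡ (solve (A ∷ g ∷ []))
  in pellians-hit A≥1 (minimal-E²−4 g≥1 (trans (sym (cong (_* E) (*-identityˡ E))) hE²≡g+4) E≢3)
       (unitOrbit-1 (trans 2d≡AhE (solve (A ∷ E ∷ []))) 4k≡A²g) 4k≡A²g
...   | yes refl with +-cancelʳ-≡ 4 g 5 (sym hE²≡g+4)
...     | refl =
  let 2d≡3A : 2 * d ≡ A * 3
      2d≡3A = trans 2d≡AhE (solve (A ∷ []))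
  in fibonacci-case A≥1 4k≡ (inj₁ 2d≡3A) (unitOrbit-1 2d≡3A 4k≡) no-fibonacci
below-square k≥1 d²≡k+a (factorisation A h E A≥1 h≥1 E≥1 a≡A²h 2d≡AhE) no-fibonacci no-pell
  | g , g≥1 , hE²≡g+4 , 4k≡ , 2[d²+k]≡ | inj₁ h≥2 with h ≟ 2 ×-dec E ≟ 2 | h ≟ 5 ×-dec E ≟ 1
... | no not-2-2 | no not-5-1 =
  pellians-hit A≥1 (minimal-h[hE²−4] h≥2 E≥1 g≥1 hE²≡g+4 not-2-2 not-5-1) (unitOrbit-2 2d≡AhE 4k≡ 2[d²+k]≡) 4k≡
... | yes (refl , refl) | _ with +-cancelʳ-≡ 4 g 4 (sym hE²≡g+4)
...   | refl = pell-case A≥1 4k≡ (trans 2d≡AhE (solve (A ∷ []))) (unitOrbit-2 2d≡AhE 4k≡ 2[d²+k]≡) no-pell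
below-square k≥1 d²≡k+a (factorisation A h E A≥1 h≥1 E≥1 a≡A²h 2d≡AhE) no-fibonacci no-pell
  | g , g≥1 , hE²≡g+4 , 4k≡ , 2[d²+k]≡ | inj₁ h≥2 | no _ | yes (refl , refl) with +-cancelʳ-≡ 4 g 1 (sym hE²≡g+4)
... | refl = fibonacci-case A≥1 4k≡ (inj₂ (trans 2d≡AhE (solve (A ∷ [])))) (unitOrbit-2 2d≡AhE 4k≡ 2[d²+k]≡) no-fibonacci

distance-above : ∀ {k m} → m ≤ k → ∣ (+ k - + m) ∣ ≡ k ∸ m
distance-above {k} {m} m≤k =
  trans (cong ∣_∣ (ℤ.[+m]-[+n]≡m⊖n k m)) (trans (ℤ.∣m⊖n∣≡∣n⊖m∣ k m) (ℤ.∣⊖∣-≤ m≤k))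

distance-below : ∀ {k m} → k ≤ m → ∣ (+ k - + m) ∣ ≡ m ∸ k
distance-below {k} {m} k≤m = trans (cong ∣_∣ (ℤ.[+m]-[+n]≡m⊖n k m)) (ℤ.∣⊖∣-≤ k≤m)

module _ {k d : ℕ} (d≥1 : 1 ≤ d) (distance∣4d² : (+ k - + (d * d)) ∣ℤ + (4 * (d * d))) where
  private
    four-square : ∀ d → 4 * (d * d) ≡ 2 * d * (2 * d)
    four-square = solve-∀
    2d≥1 : 1 ≤ 2 * d
    2d≥1 = *-mono-≤ (s≤s (z≤n {1})) d≥1

  factorise-above : d * d < k → SquareFactorisation (k ∸ d * d) (2 * d)
  factorise-above d²<k = square-divisor-split (m<n⇒0<n∸m d²<k) 2d≥1
    (subst₂ _∣_ (distance-above (<⇒≤ d²<k)) (four-square d) distance∣4d²)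

  factorise-below : k < d * d → SquareFactorisation (d * d ∸ k) (2 * d)
  factorise-below k<d² = square-divisor-split (m<n⇒0<n∸m k<d²) 2d≥1
    (subst₂ _∣_ (distance-below (<⇒≤ k<d²)) (four-square d) distance∣4d²)

corollary6p8 : (k d : ℕ) → 0 < k → (∀ m → m * m ≢ k) → 0 < d →
    ((+ k) - (+ (d * d))) ∣ℤ (+ (4 * (d * d))) →
    ¬ (∃[ s ] (0 < s × k ≡ 5 * (s * s) × (d ≡ 3 * s ⊎ d ≡ 5 * s) × (∃[ n ] ((2 * s) ∣ F (2 * n + 1))))) →
    ¬ (∃[ s ] (0 < s × k ≡ 2 * (s * s) × d ≡ 2 * s × (∃[ n ] (s ∣ G (2 * n + 1))))) →
    (p q : ℕ) → 0 < p → 0 < q → (p * p ≡ k * (q * q) + 1 ⊎ p * p + 1 ≡ k * (q * q)) →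
    ∃[ n ] (1 ≤ n × OrbitHits k d n p q)
corollary6p8 k d k>0 k-nonsquare d>0 distance∣4d² no-fibonacci no-pell p q p>0 q>0 pellian
  with <-cmp (d * d) k
... | tri< d²<k _ _ = above-square (sym (m+[n∸m]≡n (<⇒≤ d²<k)))
  (factorise-above d>0 distance∣4d² d²<k) p>0 q>0 pellian
... | tri≈ _ d²≡k _ = ⊥-elim (k-nonsquare d d²≡k)
... | tri> _ _ k<d² = below-square k>0 (sym (m+[n∸m]≡n (<⇒≤ k<d²)))
  (factorise-below d>0 distance∣4d² k<d²) no-fibonacci no-pell p>0 q>0 pellian
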